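{- Let $\mathcal{G}=(B\cup W,E)$ be a finite bipartite planar graph (embedded in the plane, without boundary vertices), let $\mathbf{n}:B\cup W\to\mathbb{Z}_{>0}$, and fix a cilium at every vertex $v$ with $n_v$ even. Let $\epsilon:E\to\{\pm1\}$ be a Kasteleyn connection, i.e. for every bounded face $f$ of $\mathcal{G}$, with $2\ell$ edges and with $k_f$ cilia lying in $f$, one has $\prod_{e\in\partial f}\epsilon_e=(-1)^{\ell+1+k_f}$. Then for every loop (simple closed cycle) $\gamma$ in $\mathcal{G}$ of length $L$, $$\prod_{e\in\gamma}\epsilon_e=(-1)^{L/2+1+k+n_{\mathrm{int}}},$$ where $k$ is the number of cilia at vertices of $\gamma$ that point into $\gamma$ (i.e. lie in the region enclosed by $\gamma$), and $n_{\mathrm{int}}=\sum_v n_v$, the sum over the vertices $v$ strictly enclosed by $\gamma$.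
   Context: A cilium at a vertex $v$ is a choice of one of the angular wedges between two circularly consecutive edges at $v$ in the planar embedding; it therefore lies in a unique face incident to $v$, and "the number of cilia lying in a face $f$" counts the vertices on the boundary of $f$ whose cilium lies in $f$. Cilia are only specified at vertices of even multiplicity $n_v$, so only those are counted. The product $\prod_{e\in\gamma}\epsilon_e$ is the monodromy of the $\pm1$-connection $\epsilon$ around $\gamma$. -}

module Defs where

open import Data.Nat using (ℕ; zero; suc; _+_; _*_; _<_; _%_; _/_; _≡ᵇ_)
open import Data.Nat.ListAction using (sum)
open import Data.Fin using (Fin; zero; suc; _≟_)
open import Data.Bool using (Bool; true; false; _∧_; _∨_; not; if_then_else_)
open import Data.List using (List; map; foldr)
open import Data.List.Base using (allFin)
open import Data.Sign using (Sign) renaming (_*_ to _*ₛ_; + to plus; - to minus)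
open import Data.Product using (∃; _×_)
open import Relation.Binary.PropositionalEquality using (_≡_; _≢_)
open import Relation.Nullary.Decidable using (does)

iter : ∀ {A : Set} → (A → A) → ℕ → A → A
iter f zero x = x
iter f (suc k) x = f (iter f k x)

-- cyclic successor on Fin (suc m): i ↦ i+1 mod (suc m)
cyc : ∀ {m} → Fin (suc m) → Fin (suc m)
cyc {zero} zero = zero
cyc {suc m} zero = suc zero
cyc {suc m} (suc i) = wrap (cyc {m} i)
  where
  wrap : Fin (suc m) → Fin (suc (suc m))
  wrap zero = zero
  wrap (suc j) = suc (suc j)

anyFin : (n : ℕ) → (Fin n → Bool) → Bool
anyFin n p = foldr _∨_ false (map p (allFin n))

countFin : (n : ℕ) → (Fin n → Bool) → ℕ
countFin n p = sum (map (λ i → if p i then 1 else 0) (allFin n))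

sumFin : (n : ℕ) → (Fin n → ℕ) → ℕ
sumFin n f = sum (map f (allFin n))

prodFin : (n : ℕ) → (Fin n → Sign) → Sign
prodFin n f = foldr _*ₛ_ plus (map f (allFin n))

signPow : ℕ → Sign
signPow zero = plus
signPow (suc k) = minus *ₛ signPow k

isEven : ℕ → Bool
isEven k = (k % 2) ≡ᵇ 0

data Reach {nD nV : ℕ} (tail : Fin nD → Fin nV) (α : Fin nD → Fin nD) :
           Fin nV → Fin nV → Set where
  here : ∀ v → Reach tail α v v
  step : ∀ x {w} → Reach tail α (tail (α x)) w → Reach tail α (tail x) w

-- A finite connected bipartite plane graph, given as a combinatorial map
-- (rotation system) on darts Fin nD, together with a choice of outer face.
--  * α : dart ↦ opposite dart (fixed-point-free involution); edges = α-orbits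
--  * σ : counterclockwise rotation of darts around their tail vertex;
--        vertices = σ-orbits (labelled by tail)
--  * faces = orbits of φ = σ ∘ α (labelled by face); face x is the face
--        on the right of dart x; the wedge between x and σ x at tail x lies
--        in face (σ x).
--  * planarity: connected and Euler's formula V - E + F = 2.
record PlaneBipartiteMap : Set where
  field
    nD nV nE nF : ℕ
    α σ σ⁻ : Fin nD → Fin nD
    α-invol : ∀ x → α (α x) ≡ x
    α-nofix : ∀ x → α x ≢ x
    σσ⁻ : ∀ x → σ (σ⁻ x) ≡ x
    σ⁻σ : ∀ x → σ⁻ (σ x) ≡ x
    tail : Fin nD → Fin nV
    tail-surj : ∀ v → ∃ λ x → tail x ≡ v
    tail-orbit₁ : ∀ x y → tail x ≡ tail y → ∃ λ k → iter σ k x ≡ y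
    tail-orbit₂ : ∀ x k → tail (iter σ k x) ≡ tail x
    face : Fin nD → Fin nF
    face-surj : ∀ f → ∃ λ x → face x ≡ f
    face-orbit₁ : ∀ x y → face x ≡ face y → ∃ λ k → iter (λ z → σ (α z)) k x ≡ y
    face-orbit₂ : ∀ x k → face (iter (λ z → σ (α z)) k x) ≡ face x
    darts-edges : nD ≡ 2 * nE
    connected : ∀ u v → Reach tail α u v
    euler : nV + nF ≡ nE + 2
    colour : Fin nV → Bool
    bipartite : ∀ x → colour (tail x) ≢ colour (tail (α x))
    outer : Fin nF

module _ (M : PlaneBipartiteMap) where
  open PlaneBipartiteMap M

  -- number of darts on the boundary of face f (= number of boundary edges 2ℓ)
  faceSize : Fin nF → ℕ
  faceSize f = countFin nD (λ x → does (face x ≟ f))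

  faceProd : (Fin nD → Sign) → Fin nF → Sign
  faceProd ε f = prodFin nD (λ x → if does (face x ≟ f) then ε x else plus)

  ciliaIn : (Fin nV → ℕ) → (Fin nV → Fin nD) → Fin nF → ℕ
  ciliaIn n cil f = countFin nV (λ v → isEven (n v) ∧ does (face (σ (cil v)) ≟ f))

  IsKasteleyn : (Fin nV → ℕ) → (Fin nV → Fin nD) → (Fin nD → Sign) → Set
  IsKasteleyn n cil ε = ∀ f → f ≢ outer →
    faceProd ε f ≡ signPow (faceSize f / 2 + 1 + ciliaIn n cil f)

  record IsSimpleCycle (m : ℕ) (γ : Fin (suc m) → Fin nD) : Set where
    field
      consecutive : ∀ i → tail (α (γ i)) ≡ tail (γ (cyc i))
      distinct-vertices : ∀ i j → tail (γ i) ≡ tail (γ j) → i ≡ j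
      distinct-edges : ∀ i j → γ i ≢ α (γ j)

  inCycle : ∀ {m} → (Fin (suc m) → Fin nD) → Fin nD → Bool
  inCycle {m} γ x = anyFin (suc m) (λ i → does (γ i ≟ x) ∨ does (γ i ≟ α x))

  onCycle : ∀ {m} → (Fin (suc m) → Fin nD) → Fin nV → Bool
  onCycle {m} γ v = anyFin (suc m) (λ i → does (tail (γ i) ≟ v))

  -- inside : faces ↦ true iff enclosed by γ. Characterised as the
  -- two-colouring of faces that flips exactly across edges of γ and is
  -- false on the outer face (parity of crossings of γ).
  record IsInterior {m} (γ : Fin (suc m) → Fin nD) (inside : Fin nF → Bool) : Set where
    field
      outer-outside : inside outer ≡ false
      cross : ∀ x → inCycle γ x ≡ true → inside (face x) ≢ inside (face (α x))
      same : ∀ x → inCycle γ x ≡ false → inside (face x) ≡ inside (face (α x))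

  enclosed : ∀ {m} → (Fin (suc m) → Fin nD) → (Fin nF → Bool) → Fin nV → Bool
  enclosed γ inside v =
    not (onCycle γ v) ∧ anyFin nD (λ x → does (tail x ≟ v) ∧ inside (face x))

  nInt : ∀ {m} → (Fin (suc m) → Fin nD) → (Fin nF → Bool) → (Fin nV → ℕ) → ℕ
  nInt γ inside n = sumFin nV (λ v → if enclosed γ inside v then n v else 0)

  ciliaInside : ∀ {m} → (Fin (suc m) → Fin nD) → (Fin nF → Bool) →
                (Fin nV → ℕ) → (Fin nV → Fin nD) → ℕ
  ciliaInside {m} γ inside n cil =
    countFin (suc m) (λ i → isEven (n (tail (γ i))) ∧ inside (face (σ (cil (tail (γ i))))))

{-# OPTIONS --safe #-}

-- Cut the map open along γ and keep its inside: the darts with α restricted to the edges off γ and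
-- φ restricted to the inside faces form permutations with φ = σ ∘ α. Since a permutation of N points
-- has sign (-1)^(N - #orbits) and the sign is multiplicative, the orbit counts satisfy Euler's
-- relation for the inside modulo 2: F_in ≡ 1 + V_in + E_in. Multiplying the Kasteleyn condition
-- over the inside faces, every inside edge contributes its sign twice, so the exponent of the
-- product of ε along γ is Σ (ℓ_f + 1 + k_f) over the inside faces. Counting black corners, faces
-- and cilia, this is L/2 + E_in + F_in + k + #(even enclosed vertices), and Euler's relation turns
-- it into L/2 + 1 + k + #(odd enclosed vertices), which has the parity of L/2 + 1 + k + n_int.

module Submission where

open import Defs
open import Data.Nat using (ℕ; suc; _+_; _<_; _/_)
open import Data.Fin using (Fin)
open import Data.Bool using (Bool; true)
open import Data.Sign using (Sign)
open import Relation.Binary.PropositionalEquality using (_≡_)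

open import Data.Bool using (false; not; _∧_; _∨_; _xor_; if_then_else_)
open import Data.Bool.Properties
  using (∧-identityʳ; ∧-zeroʳ; ∨-comm; ∧-distribˡ-xor; xor-assoc; xor-same; xor-annihilates-not;
         not-involutive; not-injective; not-¬; ¬-not; if-float; if-∧; if-eta)
open import Data.Fin using (zero; suc; toℕ; fromℕ; inject₁)
open import Data.Fin.Induction using (<-weakInduction)
open import Data.Fin.Permutation using (permutation)
open import Data.Fin.Permutation.Components using (transpose; transpose-inverse)
open import Data.Fin.Properties using (_≟_; _<?_; <-irrefl; <-asym; <-trans; <-cmp; pigeonhole)
import Data.List as List
open import Data.List using (map; allFin)
open import Data.List.Properties using (map-cong)
open import Data.Nat using (zero; _*_; _∸_; _≤_; z≤n; s≤s; parity)
open import Data.Nat.DivMod using (m*n/n≡m)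
import Data.Nat.Properties as ℕ
open import Data.Nat.Tactic.RingSolver using (solve-∀)
open import Data.Parity.Base as ℙ using (0ℙ; 1ℙ; toSign)
open import Data.Parity.Properties as ℙ using (p+p≡0ℙ; +-homo-+; toSign-injective)
open import Data.Product using (Σ; _×_; _,_; proj₁; proj₂)
open import Data.Sign using () renaming (_*_ to _*ₛ_; + to plus; - to minus)
import Data.Sign.Properties as 𝕊
open import Data.Sum using (_⊎_; inj₁; inj₂)
import Data.Vec.Functional as Vector
open import Function using (_∘_)
open import Function.Definitions using (Injective)
open import Relation.Binary using (tri<; tri≈; tri>)
open import Relation.Binary.PropositionalEquality
open import Relation.Nullary using (Dec; yes; no; contradiction)
open import Relation.Nullary.Decidable using (does; dec-true; dec-false)
open import Algebra.Properties.CommutativeMonoid.Sum ℕ.+-0-commutativeMonoid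
  using (sum; sum-syntax; sum-cong-≗; ∑-distrib-+; ∑-comm; ∑-permute; sum-replicate-zero)

⟦_⟧ : Bool → ℕ
⟦ b ⟧ = if b then 1 else 0

⟦∧⟧≡if : ∀ a b → ⟦ a ∧ b ⟧ ≡ (if b then ⟦ a ⟧ else 0)
⟦∧⟧≡if true b = refl
⟦∧⟧≡if false true = refl
⟦∧⟧≡if false false = refl

does-true : ∀ {p} {P : Set p} (d : Dec P) → does d ≡ true → P
does-true (yes p) _ = p

bool-cases : ∀ {p} {P : Set p} (b : Bool) → (b ≡ true → P) → (b ≡ false → P) → P
bool-cases true t f = t refl
bool-cases false t f = f refl

∧-true : ∀ {a b} → (a ∧ b) ≡ true → a ≡ true × b ≡ true
∧-true {true} b≡true = refl , b≡true

∧-intro : ∀ {a b} → a ≡ true → b ≡ true → (a ∧ b) ≡ true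
∧-intro refl refl = refl

∨-true : ∀ {a b} → (a ∨ b) ≡ true → a ≡ true ⊎ b ≡ true
∨-true {true} _ = inj₁ refl
∨-true {false} b≡true = inj₂ b≡true

not-true : ∀ {b} → not b ≡ true → b ≡ false
not-true {false} _ = refl

∑-zero : ∀ n → ∑[ i < n ] 0 ≡ 0
∑-zero = sum-replicate-zero

∑-one : ∀ n → ∑[ i < n ] 1 ≡ n
∑-one zero = refl
∑-one (suc n) = cong suc (∑-one n)

∑-distrib-+₄ : ∀ {n} (f g h k : Fin n → ℕ) →
  ∑[ i < n ] ((f i + g i) + (h i + k i)) ≡ (∑[ i < n ] f i + ∑[ i < n ] g i) + (∑[ i < n ] h i + ∑[ i < n ] k i)
∑-distrib-+₄ {n} f g h k = trans (∑-distrib-+ {n} _ _) (cong₂ _+_ (∑-distrib-+ {n} f g) (∑-distrib-+ {n} h k))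

∑-select : ∀ n (z : Fin n) (w : Fin n → ℕ) →
  ∑[ x < n ] (if does (x ≟ z) then w x else 0) ≡ w z
∑-select (suc n) zero w = trans (cong (w zero +_) (∑-zero n)) (ℕ.+-identityʳ _)
∑-select (suc n) (suc z) w = ∑-select n z (w ∘ suc)

∑-unique : ∀ n (P : Fin n → Bool) (w : Fin n → ℕ) x₀ → P x₀ ≡ true →
  (∀ x → P x ≡ true → x ≡ x₀) → ∑[ x < n ] (if P x then w x else 0) ≡ w x₀
∑-unique n P w x₀ Px₀ unique = trans (sum-cong-≗ same) (∑-select n x₀ w)
  where
  same : ∀ x → (if P x then w x else 0) ≡ (if does (x ≟ x₀) then w x else 0)
  same x with P x in Px | x ≟ x₀
  ... | true  | yes _ = refl
  ... | true  | no x≢x₀ = contradiction (unique x Px) x≢x₀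
  ... | false | yes refl = contradiction (trans (sym Px₀) Px) λ ()
  ... | false | no _ = refl

∑-none : ∀ n (P : Fin n → Bool) (w : Fin n → ℕ) → (∀ x → P x ≡ false) →
  ∑[ x < n ] (if P x then w x else 0) ≡ 0
∑-none n P w none = trans (sum-cong-≗ (λ x → cong (if_then w x else 0) (none x))) (∑-zero n)

∑-select′ : ∀ n (z : Fin n) (w : Fin n → ℕ) →
  ∑[ x < n ] (if does (z ≟ x) then w x else 0) ≡ w z
∑-select′ n z w = ∑-unique n (λ x → does (z ≟ x)) w z (dec-true (z ≟ z) refl)
  (λ x z≡x → sym (does-true (z ≟ x) z≡x))

∑-fibres : ∀ n m (h : Fin n → Fin m) (w : Fin n → ℕ) →
  ∑[ v < m ] ∑[ x < n ] (if does (h x ≟ v) then w x else 0) ≡ ∑[ x < n ] w x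
∑-fibres n m h w = trans (∑-comm {m} {n} _) (sum-cong-≗ (λ x → ∑-select′ m (h x) (λ _ → w x)))

∑-if : ∀ n (c : Bool) (f : Fin n → ℕ) → ∑[ j < n ] (if c then f j else 0) ≡ (if c then ∑[ j < n ] f j else 0)
∑-if n true f = refl
∑-if n false f = ∑-zero n

∑-fibres-restricted : ∀ n m (h : Fin n → Fin m) (P : Fin m → Bool) (w : Fin n → ℕ) →
  ∑[ v < m ] (if P v then ∑[ x < n ] (if does (h x ≟ v) then w x else 0) else 0) ≡
  ∑[ x < n ] (if P (h x) then w x else 0)
∑-fibres-restricted n m h P w =
  trans (sum-cong-≗ (λ v → trans (sym (∑-if n (P v) _)) (sum-cong-≗ (λ x → restrict x v))))
        (∑-fibres n m h (λ x → if P (h x) then w x else 0))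
  where
  restrict : ∀ x v → (if P v then (if does (h x ≟ v) then w x else 0) else 0) ≡
                     (if does (h x ≟ v) then (if P (h x) then w x else 0) else 0)
  restrict x v with h x ≟ v
  ... | yes refl = refl
  ... | no _ = if-eta (P v)

∑-reindex : ∀ n (π ρ : Fin n → Fin n) → (∀ x → ρ (π x) ≡ x) → (∀ y → π (ρ y) ≡ y) →
  (g : Fin n → ℕ) → ∑[ x < n ] g (π x) ≡ ∑[ x < n ] g x
∑-reindex n π ρ ρπ πρ g = sym (∑-permute g (permutation π ρ πρ ρπ))

∑-split : ∀ n (A B : Fin n → Bool) (w : Fin n → ℕ) →
  ∑[ i < n ] (if A i then w i else 0) ≡
  ∑[ i < n ] (if A i ∧ B i then w i else 0) + ∑[ i < n ] (if A i ∧ not (B i) then w i else 0)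
∑-split n A B w = trans (sum-cong-≗ (λ i → split (A i) (B i) (w i))) (∑-distrib-+ {n} _ _)
  where
  split : ∀ a b k → (if a then k else 0) ≡ (if a ∧ b then k else 0) + (if a ∧ not b then k else 0)
  split true true k = sym (ℕ.+-identityʳ k)
  split true false k = refl
  split false b k = refl

∑-mono : ∀ n (f g : Fin n → ℕ) → (∀ i → f i ≤ g i) → ∑[ i < n ] f i ≤ ∑[ i < n ] g i
∑-mono zero f g f≤g = z≤n
∑-mono (suc n) f g f≤g = ℕ.+-mono-≤ (f≤g zero) (∑-mono n _ _ (f≤g ∘ suc))

∑-mono-< : ∀ n (f g : Fin n → ℕ) → (∀ i → f i ≤ g i) → ∀ b → f b < g b →
  ∑[ i < n ] f i < ∑[ i < n ] g i
∑-mono-< (suc n) f g f≤g zero fb<gb = ℕ.+-mono-<-≤ fb<gb (∑-mono n _ _ (f≤g ∘ suc))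
∑-mono-< (suc n) f g f≤g (suc b) fb<gb = ℕ.+-mono-≤-< (f≤g zero) (∑-mono-< n _ _ (f≤g ∘ suc) b fb<gb)

search : ∀ n (P : Fin n → Bool) → Σ (Fin n) (λ x → P x ≡ true) ⊎ (∀ x → P x ≡ false)
search zero P = inj₂ λ ()
search (suc n) P with P zero in P0 | search n (P ∘ suc)
... | true  | _ = inj₁ (zero , P0)
... | false | inj₁ (x , Px) = inj₁ (suc x , Px)
... | false | inj₂ none = inj₂ λ { zero → P0 ; (suc x) → none x }

half-double : ∀ a → (a + a) / 2 ≡ a
half-double a = trans (cong (_/ 2) (trans (cong (a +_) (sym (ℕ.+-identityʳ a))) (ℕ.*-comm 2 a))) (m*n/n≡m a 2)

parity-double : ∀ a → parity (a + a) ≡ 0ℙ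
parity-double a = trans (+-homo-+ a a) (p+p≡0ℙ (parity a))

parity-+-cong : ∀ a b c d → parity a ≡ parity c → parity b ≡ parity d → parity (a + b) ≡ parity (c + d)
parity-+-cong a b c d a≡c b≡d =
  trans (+-homo-+ a b) (trans (cong₂ ℙ._+_ a≡c b≡d) (sym (+-homo-+ c d)))

parity-+-cancelˡ : ∀ a b c → parity (a + b) ≡ parity (a + c) → parity b ≡ parity c
parity-+-cancelˡ a b c eq = ℙ.+-cancelˡ-≡ (parity a) (parity b) (parity c)
  (trans (sym (+-homo-+ a b)) (trans eq (+-homo-+ a c)))

parity-+-double : ∀ a b → parity (a + (b + b)) ≡ parity a
parity-+-double a b = trans (+-homo-+ a (b + b)) (trans (cong (parity a ℙ.+_) (parity-double b)) (ℙ.+-identityʳ _))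

parity-∑-cong : ∀ n (f g : Fin n → ℕ) → (∀ i → parity (f i) ≡ parity (g i)) →
  parity (∑[ i < n ] f i) ≡ parity (∑[ i < n ] g i)
parity-∑-cong zero f g same = refl
parity-∑-cong (suc n) f g same = parity-+-cong (f zero) (∑[ i < n ] f (suc i)) (g zero) (∑[ i < n ] g (suc i))
  (same zero) (parity-∑-cong n (f ∘ suc) (g ∘ suc) (same ∘ suc))

parity-⟦xor⟧ : ∀ a b → parity ⟦ a xor b ⟧ ≡ parity (⟦ a ⟧ + ⟦ b ⟧)
parity-⟦xor⟧ true true = refl
parity-⟦xor⟧ true false = refl
parity-⟦xor⟧ false b = refl

parity-∑-xor : ∀ n (A B : Fin n → Bool) →
  parity (∑[ i < n ] ⟦ A i xor B i ⟧) ≡ parity (∑[ i < n ] ⟦ A i ⟧ + ∑[ i < n ] ⟦ B i ⟧)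
parity-∑-xor n A B = trans (parity-∑-cong n _ _ (λ i → parity-⟦xor⟧ (A i) (B i)))
  (cong parity (∑-distrib-+ (⟦_⟧ ∘ A) (⟦_⟧ ∘ B)))

parity-⟦not-isEven⟧ : ∀ k → parity ⟦ not (isEven k) ⟧ ≡ parity k
parity-⟦not-isEven⟧ zero = refl
parity-⟦not-isEven⟧ (suc zero) = refl
parity-⟦not-isEven⟧ (suc (suc k)) = parity-⟦not-isEven⟧ k

-- The list folds of the statement as vector folds

foldr-tabulate : ∀ {A B C : Set} (_⊕_ : A → B → B) e n (g : Fin n → C) (f : C → A) →
  List.foldr _⊕_ e (map f (List.tabulate g)) ≡ Vector.foldr _⊕_ e (f ∘ g)
foldr-tabulate _⊕_ e zero g f = refl
foldr-tabulate _⊕_ e (suc n) g f = cong (f (g zero) ⊕_) (foldr-tabulate _⊕_ e n (g ∘ suc) f)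

foldr-allFin : ∀ {A B : Set} (_⊕_ : A → B → B) e n (f : Fin n → A) →
  List.foldr _⊕_ e (map f (allFin n)) ≡ Vector.foldr _⊕_ e f
foldr-allFin _⊕_ e n f = foldr-tabulate _⊕_ e n (λ i → i) f

sumFin≡∑ : ∀ n (f : Fin n → ℕ) → sumFin n f ≡ ∑[ i < n ] f i
sumFin≡∑ = foldr-allFin _+_ 0

countFin≡∑ : ∀ n (p : Fin n → Bool) → countFin n p ≡ ∑[ i < n ] ⟦ p i ⟧
countFin≡∑ n p = foldr-allFin _+_ 0 n (⟦_⟧ ∘ p)

anyFin-witness : ∀ n (p : Fin n → Bool) → anyFin n p ≡ true → Σ (Fin n) λ i → p i ≡ true
anyFin-witness n p any rewrite foldr-allFin _∨_ false n p = go n p any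
  where
  go : ∀ n (p : Fin n → Bool) → Vector.foldr _∨_ false p ≡ true → Σ (Fin n) λ i → p i ≡ true
  go (suc n) p any with p zero in p0
  ... | true = zero , p0
  ... | false with go n (p ∘ suc) any
  ...   | i , pi = suc i , pi

anyFin-intro : ∀ n (p : Fin n → Bool) i → p i ≡ true → anyFin n p ≡ true
anyFin-intro n p i pi rewrite foldr-allFin _∨_ false n p = go n p i pi
  where
  go : ∀ n (p : Fin n → Bool) i → p i ≡ true → Vector.foldr _∨_ false p ≡ true
  go (suc n) p zero p0 rewrite p0 = refl
  go (suc n) p (suc i) pi with p zero
  ... | true = refl
  ... | false = go n (p ∘ suc) i pi

anyFin-cong : ∀ n (p q : Fin n → Bool) → (∀ i → p i ≡ q i) → anyFin n p ≡ anyFin n q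
anyFin-cong n p q p≗q = cong (List.foldr _∨_ false) (map-cong p≗q (allFin n))

signExponent : Sign → ℕ
signExponent minus = 1
signExponent plus = 0

signPow-+ : ∀ a b → signPow (a + b) ≡ signPow a *ₛ signPow b
signPow-+ zero b = refl
signPow-+ (suc a) b = trans (cong (minus *ₛ_) (signPow-+ a b)) (sym (𝕊.*-assoc minus (signPow a) _))

prodFin≡signPow : ∀ n (f : Fin n → Sign) → prodFin n f ≡ signPow (∑[ i < n ] signExponent (f i))
prodFin≡signPow n f = trans (foldr-allFin _*ₛ_ plus n f) (go n f)
  where
  signPow-signExponent : ∀ s → signPow (signExponent s) ≡ s
  signPow-signExponent minus = refl
  signPow-signExponent plus = refl
  go : ∀ n (f : Fin n → Sign) → Vector.foldr _*ₛ_ plus f ≡ signPow (∑[ i < n ] signExponent (f i))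
  go zero f = refl
  go (suc n) f = sym (trans (signPow-+ (signExponent (f zero)) _)
    (cong₂ _*ₛ_ (signPow-signExponent (f zero)) (sym (go n (f ∘ suc)))))

signPow≡toSign∘parity : ∀ k → signPow k ≡ toSign (parity k)
signPow≡toSign∘parity zero = refl
signPow≡toSign∘parity (suc zero) = refl
signPow≡toSign∘parity (suc (suc k)) = trans (𝕊.opposite-involutive (signPow k)) (signPow≡toSign∘parity k)

signPow-injective : ∀ a b → signPow a ≡ signPow b → parity a ≡ parity b
signPow-injective a b eq = toSign-injective
  (trans (sym (signPow≡toSign∘parity a)) (trans eq (signPow≡toSign∘parity b)))

signPow-cong : ∀ a b → parity a ≡ parity b → signPow a ≡ signPow b
signPow-cong a b eq = trans (signPow≡toSign∘parity a)
  (trans (cong toSign eq) (sym (signPow≡toSign∘parity b)))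

iter-suc : ∀ {A : Set} (f : A → A) k x → iter f (suc k) x ≡ iter f k (f x)
iter-suc f zero x = refl
iter-suc f (suc k) x = cong f (iter-suc f k x)

iter-+ : ∀ {A : Set} (f : A → A) k l x → iter f (k + l) x ≡ iter f k (iter f l x)
iter-+ f zero l x = refl
iter-+ f (suc k) l x = cong f (iter-+ f k l x)

iter-* : ∀ {A : Set} (f : A → A) p x → iter f p x ≡ x → ∀ k → iter f (k * p) x ≡ x
iter-* f p x fix zero = refl
iter-* f p x fix (suc k) = trans (iter-+ f p (k * p) x) (trans (cong (iter f p) (iter-* f p x fix k)) fix)

iter-injective : ∀ {A : Set} (f : A → A) → Injective _≡_ _≡_ f → ∀ k → Injective _≡_ _≡_ (iter f k)
iter-injective f inj zero eq = eq
iter-injective f inj (suc k) eq = iter-injective f inj k (inj eq)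

iter-period : ∀ {N} (f : Fin N → Fin N) → Injective _≡_ _≡_ f →
  ∀ x → Σ ℕ λ p → iter f (suc p) x ≡ x
iter-period {N} f inj x with pigeonhole (ℕ.n<1+n N) (λ i → iter f (toℕ i) x)
... | i , j , i<j , fⁱx≡fʲx = d ∸ 1 , (begin
  iter f (suc (d ∸ 1)) x ≡⟨ cong (λ k → iter f k x) (ℕ.m+[n∸m]≡n (ℕ.m<n⇒0<n∸m i<j)) ⟩
  iter f d x             ≡⟨ iter-injective f inj (toℕ i) fⁱfᵈx≡fⁱx ⟩
  x                      ∎)
  where
  open ≡-Reasoning
  d : ℕ
  d = toℕ j ∸ toℕ i
  fⁱfᵈx≡fⁱx : iter f (toℕ i) (iter f d x) ≡ iter f (toℕ i) x
  fⁱfᵈx≡fⁱx = begin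
    iter f (toℕ i) (iter f d x) ≡⟨ iter-+ f (toℕ i) d x ⟨
    iter f (toℕ i + d) x        ≡⟨ cong (λ k → iter f k x) (trans (ℕ.+-comm (toℕ i) d) (ℕ.m∸n+n≡m (ℕ.<⇒≤ i<j))) ⟩
    iter f (toℕ j) x            ≡⟨ fⁱx≡fʲx ⟨
    iter f (toℕ i) x            ∎

iter-agree : ∀ {A : Set} (S : A → Bool) (f g : A → A) → (∀ x → S x ≡ true → f x ≡ g x) →
  (∀ x → S x ≡ true → S (f x) ≡ true) → ∀ k x → S x ≡ true → iter f k x ≡ iter g k x
iter-agree S f g f≡g closed zero x Sx = refl
iter-agree S f g f≡g closed (suc k) x Sx = begin
  iter f (suc k) x   ≡⟨ iter-suc f k x ⟩
  iter f k (f x)     ≡⟨ iter-agree S f g f≡g closed k (f x) (closed x Sx) ⟩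
  iter g k (f x)     ≡⟨ cong (iter g k) (f≡g x Sx) ⟩
  iter g k (g x)     ≡⟨ iter-suc g k x ⟨
  iter g (suc k) x   ∎
  where open ≡-Reasoning

Reaches : ∀ {A : Set} → (A → A) → A → A → Set
Reaches f x y = Σ ℕ λ k → iter f k x ≡ y

reaches-refl : ∀ {A : Set} (f : A → A) {x} → Reaches f x x
reaches-refl f = 0 , refl

reaches-step : ∀ {A : Set} (f : A → A) {x y} → Reaches f (f x) y → Reaches f x y
reaches-step f {x} (k , eq) = suc k , trans (iter-suc f k x) eq

reaches-trans : ∀ {A : Set} (f : A → A) {x y z} → Reaches f x y → Reaches f y z → Reaches f x z
reaches-trans f {x} (k , eq) (l , eq′) = l + k , trans (iter-+ f l k x) (trans (cong (iter f l) eq) eq′)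

reaches-sym : ∀ {N} (f : Fin N → Fin N) → Injective _≡_ _≡_ f →
  ∀ {x y} → Reaches f x y → Reaches f y x
reaches-sym f inj {x} (k , refl) with iter-period f inj x
... | p , period = p * k , (begin
  iter f (p * k) (iter f k x) ≡⟨ iter-+ f (p * k) k x ⟨
  iter f (p * k + k) x        ≡⟨ cong (λ n → iter f n x) (trans (ℕ.+-comm (p * k) k) (ℕ.*-comm (suc p) k)) ⟩
  iter f (k * suc p) x        ≡⟨ iter-* f (suc p) x period k ⟩
  x                           ∎)
  where open ≡-Reasoning

-- Inversions and the sign of a permutation

_<ᵇ_ : ∀ {N} → Fin N → Fin N → Bool
i <ᵇ j = does (i <? j)

<ᵇ-irrefl : ∀ {N} (i : Fin N) → (i <ᵇ i) ≡ false
<ᵇ-irrefl i = dec-false (i <? i) (<-irrefl refl)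

<ᵇ-asym : ∀ {N} (i j : Fin N) → (i <ᵇ j) ≡ true → (j <ᵇ i) ≡ false
<ᵇ-asym i j i<j = dec-false (j <? i) (<-asym (does-true (i <? j) i<j))

<ᵇ-trans : ∀ {N} (i j k : Fin N) → (i <ᵇ j) ≡ true → (j <ᵇ k) ≡ true → (i <ᵇ k) ≡ true
<ᵇ-trans i j k i<j j<k =
  dec-true (i <? k) (<-trans (does-true (i <? j) i<j) (does-true (j <? k) j<k))

<ᵇ-connex : ∀ {N} {i j : Fin N} → i ≢ j → (j <ᵇ i) ≡ not (i <ᵇ j)
<ᵇ-connex {i = i} {j} i≢j with <-cmp i j
... | tri< i<j _ _ = trans (dec-false (j <? i) (<-asym i<j)) (cong not (sym (dec-true (i <? j) i<j)))
... | tri≈ _ i≡j _ = contradiction i≡j i≢j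
... | tri> _ _ j<i = trans (dec-true (j <? i) j<i) (cong not (sym (dec-false (i <? j) (<-asym j<i))))

inversions : ∀ N → (Fin N → Fin N) → ℕ
inversions N f = ∑[ i < N ] ∑[ j < N ] ⟦ i <ᵇ j ∧ f j <ᵇ f i ⟧

reverses : ∀ {N} → (Fin N → Fin N) → Fin N → Fin N → Bool
reverses f i j = (i <ᵇ j) xor (f i <ᵇ f j)

∑∑-cong : ∀ N {F G : Fin N → Fin N → ℕ} → (∀ i j → F i j ≡ G i j) →
  ∑[ i < N ] ∑[ j < N ] F i j ≡ ∑[ i < N ] ∑[ j < N ] G i j
∑∑-cong N F≡G = sum-cong-≗ (λ i → sum-cong-≗ (F≡G i))

∑∑-distrib-+ : ∀ N (F G : Fin N → Fin N → ℕ) →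
  ∑[ i < N ] ∑[ j < N ] (F i j + G i j) ≡ ∑[ i < N ] ∑[ j < N ] F i j + ∑[ i < N ] ∑[ j < N ] G i j
∑∑-distrib-+ N F G = trans (sum-cong-≗ (λ i → ∑-distrib-+ {N} (F i) (G i))) (∑-distrib-+ {N} _ _)

parity-∑∑-xor : ∀ N (A B : Fin N → Fin N → Bool) →
  parity (∑[ i < N ] ∑[ j < N ] ⟦ A i j xor B i j ⟧) ≡
  parity (∑[ i < N ] ∑[ j < N ] ⟦ A i j ⟧ + ∑[ i < N ] ∑[ j < N ] ⟦ B i j ⟧)
parity-∑∑-xor N A B =
  trans (parity-∑-cong N _ _ (λ i → parity-∑-xor N (A i) (B i)))
        (cong parity (∑-distrib-+ {N} _ _))

inversions-cong : ∀ N (f g : Fin N → Fin N) → (∀ x → f x ≡ g x) → inversions N f ≡ inversions N g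
inversions-cong N f g f≗g = ∑∑-cong N (λ i j → cong₂ (λ u v → ⟦ i <ᵇ j ∧ u <ᵇ v ⟧) (f≗g j) (f≗g i))

inversions≡∑reverses : ∀ N (f : Fin N → Fin N) → Injective _≡_ _≡_ f →
  inversions N f ≡ ∑[ i < N ] ∑[ j < N ] ⟦ i <ᵇ j ∧ reverses f i j ⟧
inversions≡∑reverses N f inj = ∑∑-cong N same
  where
  same : ∀ i j → ⟦ i <ᵇ j ∧ f j <ᵇ f i ⟧ ≡ ⟦ i <ᵇ j ∧ reverses f i j ⟧
  same i j with i <ᵇ j in i<j
  ... | false = refl
  ... | true = cong ⟦_⟧ (<ᵇ-connex (i≢j ∘ inj))
    where
    i≢j : i ≢ j
    i≢j refl = contradiction (trans (sym i<j) (<ᵇ-irrefl i)) λ ()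

reverses-∘ : ∀ {N} (f h : Fin N → Fin N) i j →
  reverses (f ∘ h) i j ≡ reverses h i j xor reverses f (h i) (h j)
reverses-∘ f h i j = sym (begin
  (a xor b) xor (b xor c) ≡⟨ xor-assoc a b (b xor c) ⟩
  a xor (b xor (b xor c)) ≡⟨ cong (a xor_) (sym (xor-assoc b b c)) ⟩
  a xor ((b xor b) xor c) ≡⟨ cong (λ z → a xor (z xor c)) (xor-same b) ⟩
  a xor c                 ∎)
  where
  open ≡-Reasoning
  a b c : Bool
  a = i <ᵇ j
  b = h i <ᵇ h j
  c = f (h i) <ᵇ f (h j)

reverses-sym : ∀ {N} (f : Fin N → Fin N) → Injective _≡_ _≡_ f → ∀ i j → reverses f j i ≡ reverses f i j
reverses-sym f inj i j with i ≟ j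
... | yes refl = refl
... | no i≢j = trans (cong₂ _xor_ (<ᵇ-connex i≢j) (<ᵇ-connex (i≢j ∘ inj))) (xor-annihilates-not (i <ᵇ j) (f i <ᵇ f j))

∑∑-order-independent : ∀ N (p q K : Fin N → Fin N → Bool) →
  (∀ i → p i i ≡ false) → (∀ {i j} → i ≢ j → p j i ≡ not (p i j)) →
  (∀ i → q i i ≡ false) → (∀ {i j} → i ≢ j → q j i ≡ not (q i j)) →
  (∀ i j → K j i ≡ K i j) →
  ∑[ i < N ] ∑[ j < N ] ⟦ p i j ∧ K i j ⟧ ≡ ∑[ i < N ] ∑[ j < N ] ⟦ q i j ∧ K i j ⟧
∑∑-order-independent N p q K p-irrefl p-connex q-irrefl q-connex K-sym = begin
  ∑[ i < N ] ∑[ j < N ] ⟦ p i j ∧ K i j ⟧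
    ≡⟨ split p q ⟩
  ∑[ i < N ] ∑[ j < N ] ⟦ p i j ∧ q i j ∧ K i j ⟧ + ∑[ i < N ] ∑[ j < N ] ⟦ p i j ∧ not (q i j) ∧ K i j ⟧
    ≡⟨ cong₂ _+_ (∑∑-cong N (λ i j → cong ⟦_⟧ (∧-swap (p i j) (q i j) (K i j))))
                 (trans (∑-comm {N} {N} _) (∑∑-cong N transposed)) ⟩
  ∑[ i < N ] ∑[ j < N ] ⟦ q i j ∧ p i j ∧ K i j ⟧ + ∑[ i < N ] ∑[ j < N ] ⟦ q i j ∧ not (p i j) ∧ K i j ⟧
    ≡⟨ split q p ⟨
  ∑[ i < N ] ∑[ j < N ] ⟦ q i j ∧ K i j ⟧ ∎
  where
  open ≡-Reasoning
  ⟦⟧-split : ∀ a b k → ⟦ a ∧ k ⟧ ≡ ⟦ a ∧ b ∧ k ⟧ + ⟦ a ∧ not b ∧ k ⟧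
  ⟦⟧-split true true k = sym (ℕ.+-identityʳ _)
  ⟦⟧-split true false k = refl
  ⟦⟧-split false b k = refl
  split : ∀ r s → ∑[ i < N ] ∑[ j < N ] ⟦ r i j ∧ K i j ⟧ ≡
    ∑[ i < N ] ∑[ j < N ] ⟦ r i j ∧ s i j ∧ K i j ⟧ + ∑[ i < N ] ∑[ j < N ] ⟦ r i j ∧ not (s i j) ∧ K i j ⟧
  split r s = trans (∑∑-cong N (λ i j → ⟦⟧-split (r i j) (s i j) (K i j))) (∑∑-distrib-+ N _ _)
  ∧-swap : ∀ a b k → (a ∧ b ∧ k) ≡ (b ∧ a ∧ k)
  ∧-swap true b k = refl
  ∧-swap false true k = refl
  ∧-swap false false k = refl
  flip-not : ∀ a b k → (not a ∧ not (not b) ∧ k) ≡ (b ∧ not a ∧ k)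
  flip-not true true k = refl
  flip-not true false k = refl
  flip-not false true k = refl
  flip-not false false k = refl
  transposed : ∀ i j → ⟦ p j i ∧ not (q j i) ∧ K j i ⟧ ≡ ⟦ q i j ∧ not (p i j) ∧ K i j ⟧
  transposed i j with i ≟ j
  ... | yes refl rewrite p-irrefl i | q-irrefl i = refl
  ... | no i≢j rewrite p-connex i≢j | q-connex i≢j | K-sym i j = cong ⟦_⟧ (flip-not (p i j) (q i j) (K i j))

-- f ∘ h reverses a pair exactly when one of h and f (on the images under h) does, and the pairs
-- reversed by f can be counted along the order transported by h.
parity-inversions-∘ : ∀ N (f h h⁻¹ : Fin N → Fin N) → Injective _≡_ _≡_ f →
  (∀ x → h⁻¹ (h x) ≡ x) → (∀ y → h (h⁻¹ y) ≡ y) →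
  parity (inversions N (f ∘ h)) ≡ parity (inversions N f + inversions N h)
parity-inversions-∘ N f h h⁻¹ f-inj h⁻¹h hh⁻¹ = begin
  parity (inversions N (f ∘ h))
    ≡⟨ cong parity (inversions≡∑reverses N (f ∘ h) (h-inj ∘ f-inj)) ⟩
  parity (∑[ i < N ] ∑[ j < N ] ⟦ i <ᵇ j ∧ reverses (f ∘ h) i j ⟧)
    ≡⟨ cong parity (∑∑-cong N (λ i j → cong ⟦_⟧ (trans (cong (i <ᵇ j ∧_) (reverses-∘ f h i j))
                                                         (∧-distribˡ-xor (i <ᵇ j) _ _)))) ⟩
  parity (∑[ i < N ] ∑[ j < N ] ⟦ (i <ᵇ j ∧ reverses h i j) xor (i <ᵇ j ∧ reverses f (h i) (h j)) ⟧)
    ≡⟨ parity-∑∑-xor N _ _ ⟩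
  parity (∑[ i < N ] ∑[ j < N ] ⟦ i <ᵇ j ∧ reverses h i j ⟧ + ∑[ i < N ] ∑[ j < N ] ⟦ i <ᵇ j ∧ reverses f (h i) (h j) ⟧)
    ≡⟨ cong parity (cong₂ _+_ (sym (inversions≡∑reverses N h h-inj)) reindexed) ⟩
  parity (inversions N h + inversions N f)
    ≡⟨ cong parity (ℕ.+-comm (inversions N h) _) ⟩
  parity (inversions N f + inversions N h) ∎
  where
  open ≡-Reasoning
  h-inj : Injective _≡_ _≡_ h
  h-inj {x} {y} hx≡hy = trans (sym (h⁻¹h x)) (trans (cong h⁻¹ hx≡hy) (h⁻¹h y))
  reindexed : ∑[ i < N ] ∑[ j < N ] ⟦ i <ᵇ j ∧ reverses f (h i) (h j) ⟧ ≡ inversions N f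
  reindexed = begin
    ∑[ i < N ] ∑[ j < N ] ⟦ i <ᵇ j ∧ reverses f (h i) (h j) ⟧
      ≡⟨ ∑∑-order-independent N _<ᵇ_ (λ i j → h i <ᵇ h j) (λ i j → reverses f (h i) (h j))
           <ᵇ-irrefl <ᵇ-connex (<ᵇ-irrefl ∘ h) (λ i≢j → <ᵇ-connex (i≢j ∘ h-inj))
           (λ i j → reverses-sym f f-inj (h i) (h j)) ⟩
    ∑[ i < N ] ∑[ j < N ] ⟦ h i <ᵇ h j ∧ reverses f (h i) (h j) ⟧
      ≡⟨ sum-cong-≗ (λ i → ∑-reindex N h h⁻¹ h⁻¹h hh⁻¹ (λ b → ⟦ h i <ᵇ b ∧ reverses f (h i) b ⟧)) ⟩
    ∑[ i < N ] ∑[ b < N ] ⟦ h i <ᵇ b ∧ reverses f (h i) b ⟧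
      ≡⟨ ∑-reindex N h h⁻¹ h⁻¹h hh⁻¹ (λ a → ∑[ b < N ] ⟦ a <ᵇ b ∧ reverses f a b ⟧) ⟩
    ∑[ a < N ] ∑[ b < N ] ⟦ a <ᵇ b ∧ reverses f a b ⟧
      ≡⟨ inversions≡∑reverses N f f-inj ⟨
    inversions N f ∎

transpose-matchˡ : ∀ {N} (a b : Fin N) → transpose a b a ≡ b
transpose-matchˡ a b rewrite dec-true (a ≟ a) refl = refl

transpose-matchʳ : ∀ {N} {a b : Fin N} → a ≢ b → transpose a b b ≡ a
transpose-matchʳ {a = a} {b} a≢b rewrite dec-false (b ≟ a) (a≢b ∘ sym) | dec-true (b ≟ b) refl = refl

transpose-other : ∀ {N} {a b x : Fin N} → x ≢ a → x ≢ b → transpose a b x ≡ x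
transpose-other {a = a} {b} {x} x≢a x≢b rewrite dec-false (x ≟ a) x≢a | dec-false (x ≟ b) x≢b = refl

data Position {N} (a b : Fin N) : Fin N → Set where
  at-a : Position a b a
  at-b : Position a b b
  elsewhere : ∀ {x} → x ≢ a → x ≢ b → Position a b x

position : ∀ {N} (a b x : Fin N) → Position a b x
position a b x with x ≟ a | x ≟ b
... | yes refl | _ = at-a
... | no _ | yes refl = at-b
... | no x≢a | no x≢b = elsewhere x≢a x≢b

transpose-comm : ∀ {N} {a b : Fin N} → a ≢ b → ∀ x → transpose a b x ≡ transpose b a x
transpose-comm {a = a} {b} a≢b x with position a b x
... | at-a = trans (transpose-matchˡ a b) (sym (transpose-matchʳ (a≢b ∘ sym)))
... | at-b = trans (transpose-matchʳ a≢b) (sym (transpose-matchˡ b a))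
... | elsewhere x≢a x≢b = trans (transpose-other x≢a x≢b) (sym (transpose-other x≢b x≢a))

-- For a < b the inversions of (a b) are (a, b) and the pairs (a, x), (x, b) with a < x < b.
inversions-transpose : ∀ N {a b : Fin N} → (a <ᵇ b) ≡ true →
  inversions N (transpose a b) ≡ suc (∑[ x < N ] ⟦ a <ᵇ x ∧ x <ᵇ b ⟧ + ∑[ x < N ] ⟦ a <ᵇ x ∧ x <ᵇ b ⟧)
inversions-transpose N {a} {b} a<b = begin
  inversions N t
    ≡⟨ ∑∑-cong N pairs ⟩
  ∑[ i < N ] ∑[ j < N ] (⟦ is a i ∧ is b j ⟧ + ⟦ is a i ∧ between j ⟧ + ⟦ is b j ∧ between i ⟧)
    ≡⟨ trans (∑∑-distrib-+ N _ _) (cong₂ _+_ (∑∑-distrib-+ N _ _) refl) ⟩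
  ∑[ i < N ] ∑[ j < N ] ⟦ is a i ∧ is b j ⟧ + ∑[ i < N ] ∑[ j < N ] ⟦ is a i ∧ between j ⟧
    + ∑[ i < N ] ∑[ j < N ] ⟦ is b j ∧ between i ⟧
    ≡⟨ cong₂ _+_ (cong₂ _+_ (at-a-row (is b)) (at-a-row between))
                 (sum-cong-≗ (λ i → trans (sum-cong-≗ (λ j → if-∧ (is b j) {between i} {1} {0})) (∑-select N b (λ _ → ⟦ between i ⟧)))) ⟩
  ∑[ j < N ] ⟦ is b j ⟧ + c + c
    ≡⟨ cong (λ z → z + c + c) (∑-select N b (λ _ → 1)) ⟩
  suc (c + c) ∎
  where
  open ≡-Reasoning
  t : Fin N → Fin N
  t = transpose a b
  is : Fin N → Fin N → Bool
  is z x = does (x ≟ z)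
  between : Fin N → Bool
  between x = a <ᵇ x ∧ x <ᵇ b
  c : ℕ
  c = ∑[ x < N ] ⟦ between x ⟧
  a≢b : a ≢ b
  a≢b refl = contradiction (trans (sym a<b) (<ᵇ-irrefl a)) λ ()
  b≮a : (b <ᵇ a) ≡ false
  b≮a = <ᵇ-asym a b a<b
  at-a-row : (g : Fin N → Bool) → ∑[ i < N ] ∑[ j < N ] ⟦ is a i ∧ g j ⟧ ≡ ∑[ j < N ] ⟦ g j ⟧
  at-a-row g = trans (sum-cong-≗ (λ i → trans (sum-cong-≗ (λ j → if-∧ (is a i) {g j} {1} {0})) (∑-if N (is a i) (⟦_⟧ ∘ g))))
    (∑-select N a (λ _ → ∑[ j < N ] ⟦ g j ⟧))
  pairs : ∀ i j → ⟦ i <ᵇ j ∧ t j <ᵇ t i ⟧ ≡ ⟦ is a i ∧ is b j ⟧ + ⟦ is a i ∧ between j ⟧ + ⟦ is b j ∧ between i ⟧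
  pairs i j with position a b i | position a b j
  ... | at-a | at-a rewrite <ᵇ-irrefl a | dec-true (a ≟ a) refl | dec-false (a ≟ b) a≢b = refl
  ... | at-a | at-b rewrite transpose-matchˡ a b | transpose-matchʳ a≢b | dec-true (a ≟ a) refl
                          | dec-true (b ≟ b) refl | a<b | <ᵇ-irrefl b | <ᵇ-irrefl a = refl
  ... | at-a | elsewhere j≢a j≢b rewrite transpose-matchˡ a b | transpose-other j≢a j≢b
                          | dec-true (a ≟ a) refl | dec-false (j ≟ b) j≢b = sym (ℕ.+-identityʳ _)
  ... | at-b | at-a rewrite b≮a | dec-false (b ≟ a) (a≢b ∘ sym) | dec-false (a ≟ b) a≢b = refl
  ... | at-b | at-b rewrite <ᵇ-irrefl b | dec-false (b ≟ a) (a≢b ∘ sym) | dec-true (b ≟ b) refl | a<b = refl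
  ... | at-b | elsewhere j≢a j≢b rewrite transpose-matchʳ a≢b | transpose-other j≢a j≢b
                          | dec-false (b ≟ a) (a≢b ∘ sym) | dec-false (j ≟ b) j≢b with b <ᵇ j in b<j
  ...   | false = refl
  ...   | true = cong ⟦_⟧ (<ᵇ-asym a j (<ᵇ-trans a b j a<b b<j))
  pairs i j | elsewhere i≢a i≢b | at-a rewrite transpose-matchˡ a b | transpose-other i≢a i≢b
                          | dec-false (i ≟ a) i≢a | dec-false (a ≟ b) a≢b with i <ᵇ a in i<a
  ...   | false = refl
  ...   | true = cong ⟦_⟧ (<ᵇ-asym i b (<ᵇ-trans i a b i<a a<b))
  pairs i j | elsewhere i≢a i≢b | at-b rewrite transpose-matchʳ a≢b | transpose-other i≢a i≢b
                          | dec-false (i ≟ a) i≢a | dec-true (b ≟ b) refl with i <ᵇ b | a <ᵇ i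
  ...   | true | true = refl
  ...   | true | false = refl
  ...   | false | true = refl
  ...   | false | false = refl
  pairs i j | elsewhere i≢a i≢b | elsewhere j≢a j≢b rewrite transpose-other i≢a i≢b | transpose-other j≢a j≢b
                          | dec-false (i ≟ a) i≢a | dec-false (j ≟ b) j≢b with i <ᵇ j in i<j
  ...   | false = refl
  ...   | true = cong ⟦_⟧ (<ᵇ-asym i j i<j)

parity-inversions-transpose-< : ∀ N {a b : Fin N} → (a <ᵇ b) ≡ true →
  parity (inversions N (transpose a b)) ≡ 1ℙ
parity-inversions-transpose-< N {a} {b} a<b = trans (cong parity (inversions-transpose N a<b))
  (trans (+-homo-+ 1 (c + c)) (cong (1ℙ ℙ.+_) (parity-double c)))
  where
  c : ℕ
  c = ∑[ x < N ] ⟦ a <ᵇ x ∧ x <ᵇ b ⟧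

parity-inversions-transpose : ∀ N {a b : Fin N} → a ≢ b → parity (inversions N (transpose a b)) ≡ 1ℙ
parity-inversions-transpose N {a} {b} a≢b with a <ᵇ b in a<b
... | true = parity-inversions-transpose-< N a<b
... | false = trans (cong parity (inversions-cong N _ _ (transpose-comm a≢b)))
                   (parity-inversions-transpose-< N (trans (<ᵇ-connex a≢b) (cong not a<b)))

-- rep picks one point in each orbit of π, so the orbits are counted by the fixed points of rep.
record OrbitChoice (N : ℕ) (π : Fin N → Fin N) : Set where
  field
    rep : Fin N → Fin N
    rep-invariant : ∀ x → rep (π x) ≡ rep x
    rep-reaches : ∀ x y → rep x ≡ rep y → Reaches π x y
    rep-idempotent : ∀ x → rep (rep x) ≡ rep x

  orbits : ℕ
  orbits = ∑[ x < N ] ⟦ does (rep x ≟ x) ⟧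

moved : ∀ N → (Fin N → Fin N) → ℕ
moved N π = ∑[ x < N ] ⟦ not (does (π x ≟ x)) ⟧

-- Composing π with the transposition of a and π a splits π a off as a fixed point.
module SplitOff {N} (π : Fin N → Fin N) (π-inj : Injective _≡_ _≡_ π) (O : OrbitChoice N π)
                (a : Fin N) (πa≢a : π a ≢ a) where

  open OrbitChoice O

  b : Fin N
  b = π a

  a≢b : a ≢ b
  a≢b = πa≢a ∘ sym

  π₁ : Fin N → Fin N
  π₁ = π ∘ transpose a b

  π≗π₁∘transpose : ∀ x → π x ≡ π₁ (transpose b a x)
  π≗π₁∘transpose x = cong π (sym (transpose-inverse a b))

  π₁-inj : Injective _≡_ _≡_ π₁
  π₁-inj {x} {y} eq = begin
    x                               ≡⟨ transpose-inverse b a ⟨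
    transpose b a (transpose a b x) ≡⟨ cong (transpose b a) (π-inj eq) ⟩
    transpose b a (transpose a b y) ≡⟨ transpose-inverse b a ⟩
    y                               ∎
    where open ≡-Reasoning

  π₁-b : π₁ b ≡ b
  π₁-b = cong π (transpose-matchʳ a≢b)

  π₁-a : π₁ a ≡ π b
  π₁-a = cong π (transpose-matchˡ a b)

  π₁-other : ∀ {x} → x ≢ a → x ≢ b → π₁ x ≡ π x
  π₁-other x≢a x≢b = cong π (transpose-other x≢a x≢b)

  πb≢b : π b ≢ b
  πb≢b πb≡b = a≢b (π-inj (sym πb≡b))

  reaches₁ : ∀ k {x y} → iter π k x ≡ y → x ≢ b → y ≢ b → Reaches π₁ x y
  reaches₁ zero eq _ _ = 0 , eq
  reaches₁ (suc k) {x} eq x≢b y≢b with x ≟ a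
  ... | no x≢a = reaches-step π₁ (subst (λ z → Reaches π₁ z _) (sym (π₁-other x≢a x≢b))
        (reaches₁ k (trans (sym (iter-suc π k x)) eq) (x≢a ∘ π-inj) y≢b))
  reaches₁ (suc zero) eq x≢b y≢b | yes refl = contradiction (sym eq) y≢b
  reaches₁ (suc (suc k)) eq x≢b y≢b | yes refl = reaches-step π₁ (subst (λ z → Reaches π₁ z _) (sym π₁-a)
        (reaches₁ k (trans (sym (iter-suc π k b)) (trans (sym (iter-suc π (suc k) a)) eq)) πb≢b y≢b))

  rename : Fin N → Fin N
  rename z = if does (z ≟ b) then a else z

  rep₁ : Fin N → Fin N
  rep₁ x = if does (x ≟ b) then b else rename (rep x)

  rep-a≡rep-b : rep a ≡ rep b
  rep-a≡rep-b = sym (rep-invariant a)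

  rep₁-b : rep₁ b ≡ b
  rep₁-b rewrite dec-true (b ≟ b) refl = refl

  rep₁-other : ∀ {x} → x ≢ b → rep₁ x ≡ rename (rep x)
  rep₁-other {x} x≢b rewrite dec-false (x ≟ b) x≢b = refl

  rep-rename : ∀ x → rep (rename (rep x)) ≡ rep x
  rep-rename x with rep x ≟ b
  ... | yes rep-x≡b = trans rep-a≡rep-b (trans (cong rep (sym rep-x≡b)) (rep-idempotent x))
  ... | no _ = rep-idempotent x

  rename≢b : ∀ x → rename (rep x) ≢ b
  rename≢b x with rep x ≟ b
  ... | yes _ = a≢b
  ... | no rep-x≢b = rep-x≢b

  rep-π₁ : ∀ x → rep (π₁ x) ≡ rep x
  rep-π₁ x with position a b x
  ... | at-a = trans (cong rep π₁-a) (trans (rep-invariant b) (sym rep-a≡rep-b))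
  ... | at-b = cong rep π₁-b
  ... | elsewhere x≢a x≢b = trans (cong rep (π₁-other x≢a x≢b)) (rep-invariant x)

  rep₁-invariant : ∀ x → rep₁ (π₁ x) ≡ rep₁ x
  rep₁-invariant x = by-cases (x ≟ b)
    where
    by-cases : Dec (x ≡ b) → rep₁ (π₁ x) ≡ rep₁ x
    by-cases (yes refl) = cong rep₁ π₁-b
    by-cases (no x≢b) = begin
      rep₁ (π₁ x)          ≡⟨ rep₁-other (λ π₁x≡b → x≢b (π₁-inj (trans π₁x≡b (sym π₁-b)))) ⟩
      rename (rep (π₁ x))  ≡⟨ cong rename (rep-π₁ x) ⟩
      rename (rep x)       ≡⟨ rep₁-other x≢b ⟨
      rep₁ x               ∎
      where open ≡-Reasoning

  rep₁-idempotent : ∀ x → rep₁ (rep₁ x) ≡ rep₁ x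
  rep₁-idempotent x = by-cases (x ≟ b)
    where
    by-cases : Dec (x ≡ b) → rep₁ (rep₁ x) ≡ rep₁ x
    by-cases (yes refl) = cong rep₁ rep₁-b
    by-cases (no x≢b) = begin
      rep₁ (rep₁ x)                 ≡⟨ cong rep₁ (rep₁-other x≢b) ⟩
      rep₁ (rename (rep x))         ≡⟨ rep₁-other (rename≢b x) ⟩
      rename (rep (rename (rep x))) ≡⟨ cong rename (rep-rename x) ⟩
      rename (rep x)                ≡⟨ rep₁-other x≢b ⟨
      rep₁ x                        ∎
      where open ≡-Reasoning

  rep₁-reaches : ∀ x y → rep₁ x ≡ rep₁ y → Reaches π₁ x y
  rep₁-reaches x y eq = by-cases (x ≟ b) (y ≟ b)
    where
    by-cases : Dec (x ≡ b) → Dec (y ≡ b) → Reaches π₁ x y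
    by-cases (yes refl) (yes refl) = reaches-refl π₁
    by-cases (yes refl) (no y≢b) =
      contradiction (trans (sym (rep₁-other y≢b)) (trans (sym eq) rep₁-b)) (rename≢b y)
    by-cases (no x≢b) (yes refl) =
      contradiction (trans (sym (rep₁-other x≢b)) (trans eq rep₁-b)) (rename≢b x)
    by-cases (no x≢b) (no y≢b) with rep-reaches x y (begin
      rep x                  ≡⟨ rep-rename x ⟨
      rep (rename (rep x))   ≡⟨ cong rep (rep₁-other x≢b) ⟨
      rep (rep₁ x)           ≡⟨ cong rep eq ⟩
      rep (rep₁ y)           ≡⟨ cong rep (rep₁-other y≢b) ⟩
      rep (rename (rep y))   ≡⟨ rep-rename y ⟩
      rep y                  ∎)
      where open ≡-Reasoning
    ... | k , πᵏx≡y = reaches₁ k πᵏx≡y x≢b y≢b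

  orbitChoice₁ : OrbitChoice N π₁
  orbitChoice₁ = record
    { rep = rep₁ ; rep-invariant = rep₁-invariant
    ; rep-reaches = rep₁-reaches ; rep-idempotent = rep₁-idempotent }

  -- {b} is a new orbit of π₁, and if b represented its π-orbit, a takes over that role.
  newFixedPoint : Fin N
  newFixedPoint = if does (rep b ≟ b) then a else b

  fixed-point-gained : ∀ x → ⟦ does (rep₁ x ≟ x) ⟧ ≡ ⟦ does (rep x ≟ x) ⟧ + ⟦ does (x ≟ newFixedPoint) ⟧
  fixed-point-gained x with position a b x
  ... | at-a = at-a-case (rep b ≟ b)
    where
    at-a-case : Dec (rep b ≡ b) → ⟦ does (rep₁ a ≟ a) ⟧ ≡ ⟦ does (rep a ≟ a) ⟧ + ⟦ does (a ≟ newFixedPoint) ⟧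
    at-a-case (yes rep-b≡b) rewrite rep₁-other a≢b | rep-a≡rep-b | rep-b≡b | dec-true (b ≟ b) refl
      | dec-true (a ≟ a) refl | dec-false (b ≟ a) (a≢b ∘ sym) = refl
    at-a-case (no rep-b≢b) rewrite rep₁-other a≢b | rep-a≡rep-b | dec-false (rep b ≟ b) rep-b≢b
      | dec-false (a ≟ b) a≢b = sym (ℕ.+-identityʳ _)
  ... | at-b = at-b-case (rep b ≟ b)
    where
    at-b-case : Dec (rep b ≡ b) → ⟦ does (rep₁ b ≟ b) ⟧ ≡ ⟦ does (rep b ≟ b) ⟧ + ⟦ does (b ≟ newFixedPoint) ⟧
    at-b-case (yes rep-b≡b) rewrite rep₁-b | rep-b≡b | dec-true (b ≟ b) refl | dec-false (b ≟ a) (a≢b ∘ sym) = refl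
    at-b-case (no rep-b≢b) rewrite rep₁-b | dec-false (rep b ≟ b) rep-b≢b | dec-true (b ≟ b) refl = refl
  ... | elsewhere x≢a x≢b = elsewhere-case (rep x ≟ b)
    where
    x≢b′ : ∀ c → x ≢ (if c then a else b)
    x≢b′ true = x≢a
    x≢b′ false = x≢b
    elsewhere-case : Dec (rep x ≡ b) → ⟦ does (rep₁ x ≟ x) ⟧ ≡ ⟦ does (rep x ≟ x) ⟧ + ⟦ does (x ≟ newFixedPoint) ⟧
    elsewhere-case (yes rep-x≡b) rewrite rep₁-other x≢b | dec-false (x ≟ newFixedPoint) (x≢b′ (does (rep b ≟ b)))
      | rep-x≡b | dec-true (b ≟ b) refl | dec-false (a ≟ x) (x≢a ∘ sym) | dec-false (b ≟ x) (x≢b ∘ sym) = refl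
    elsewhere-case (no rep-x≢b) rewrite rep₁-other x≢b | dec-false (x ≟ newFixedPoint) (x≢b′ (does (rep b ≟ b)))
      | dec-false (rep x ≟ b) rep-x≢b = sym (ℕ.+-identityʳ _)

  orbits₁ : OrbitChoice.orbits orbitChoice₁ ≡ suc orbits
  orbits₁ = begin
    ∑[ x < N ] ⟦ does (rep₁ x ≟ x) ⟧                               ≡⟨ sum-cong-≗ fixed-point-gained ⟩
    ∑[ x < N ] (⟦ does (rep x ≟ x) ⟧ + ⟦ does (x ≟ newFixedPoint) ⟧) ≡⟨ ∑-distrib-+ {N} _ _ ⟩
    orbits + ∑[ x < N ] ⟦ does (x ≟ newFixedPoint) ⟧                ≡⟨ cong (orbits +_) (∑-select N newFixedPoint (λ _ → 1)) ⟩
    orbits + 1                                                      ≡⟨ ℕ.+-comm orbits 1 ⟩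
    suc orbits                                                      ∎
    where open ≡-Reasoning

  moved₁<moved : moved N π₁ < moved N π
  moved₁<moved = ∑-mono-< N _ _ fewer b b-settled
    where
    fewer : ∀ x → ⟦ not (does (π₁ x ≟ x)) ⟧ ≤ ⟦ not (does (π x ≟ x)) ⟧
    fewer x with π x ≟ x
    ... | no _ = ⟦⟧≤1 _
      where
      ⟦⟧≤1 : ∀ c → ⟦ c ⟧ ≤ 1
      ⟦⟧≤1 true = ℕ.≤-refl
      ⟦⟧≤1 false = z≤n
    ... | yes πx≡x = ℕ.≤-reflexive (cong (⟦_⟧ ∘ not) (dec-true (π₁ x ≟ x)
            (trans (π₁-other (λ { refl → πa≢a πx≡x }) (λ { refl → πb≢b πx≡x })) πx≡x)))
    b-settled : ⟦ not (does (π₁ b ≟ b)) ⟧ < ⟦ not (does (π b ≟ b)) ⟧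
    b-settled rewrite π₁-b | dec-true (b ≟ b) refl | dec-false (π b ≟ b) πb≢b = s≤s z≤n

parity-inversions-orbits : ∀ N (π : Fin N → Fin N) → Injective _≡_ _≡_ π → (O : OrbitChoice N π) →
  parity (inversions N π) ≡ parity (N + OrbitChoice.orbits O)
parity-inversions-orbits N π π-inj O = by-moved (moved N π) π ℕ.≤-refl π-inj O
  where
  by-moved : ∀ k (π : Fin N → Fin N) → moved N π ≤ k → Injective _≡_ _≡_ π → (O : OrbitChoice N π) →
    parity (inversions N π) ≡ parity (N + OrbitChoice.orbits O)
  by-moved k π bound π-inj O with search N (λ x → not (does (π x ≟ x)))
  ... | inj₂ fixes = trans (cong parity no-inversions) (sym (trans (cong (λ o → parity (N + o)) all-orbits) (parity-double N)))
    where
    open OrbitChoice O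
    π≗id : ∀ x → π x ≡ x
    π≗id x = does-true (π x ≟ x) (ℕ-not-injective (fixes x))
      where
      ℕ-not-injective : ∀ {c} → not c ≡ false → c ≡ true
      ℕ-not-injective {true} _ = refl
    no-inversions : inversions N π ≡ 0
    no-inversions = trans (∑∑-cong N (λ i j → cong₂ (λ u v → ⟦ i <ᵇ j ∧ u <ᵇ v ⟧) (π≗id j) (π≗id i)))
      (trans (∑∑-cong N (λ i j → cong ⟦_⟧ (asym i j))) (trans (sum-cong-≗ {N} (λ i → ∑-zero N)) (∑-zero N)))
      where
      asym : ∀ i j → (i <ᵇ j ∧ j <ᵇ i) ≡ false
      asym i j with i <ᵇ j in i<j
      ... | false = refl
      ... | true = <ᵇ-asym i j i<j
    rep≗id : ∀ x → rep x ≡ x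
    rep≗id x with rep-reaches x (rep x) (sym (rep-idempotent x))
    ... | k , πᵏx≡rep-x = trans (sym πᵏx≡rep-x) (iter-id k)
      where
      iter-id : ∀ k → iter π k x ≡ x
      iter-id zero = refl
      iter-id (suc k) = trans (π≗id _) (iter-id k)
    all-orbits : orbits ≡ N
    all-orbits = trans (sum-cong-≗ (λ x → cong ⟦_⟧ (dec-true (rep x ≟ x) (rep≗id x)))) (∑-one N)
  by-moved zero π bound π-inj O | inj₁ (a , moves-a) =
    contradiction (subst (moved N π ≤_) (sym (∑-zero N)) bound)
      (ℕ.<⇒≱ (∑-mono-< N (λ _ → 0) _ (λ _ → z≤n) a (subst (λ c → 0 < ⟦ c ⟧) (sym moves-a) (s≤s z≤n))))
  by-moved (suc k) π bound π-inj O | inj₁ (a , moves-a) = begin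
    parity (inversions N π)
      ≡⟨ cong parity (inversions-cong N _ _ π≗π₁∘transpose) ⟩
    parity (inversions N (π₁ ∘ transpose b a))
      ≡⟨ parity-inversions-∘ N π₁ (transpose b a) (transpose a b) π₁-inj (λ _ → transpose-inverse a b) (λ _ → transpose-inverse b a) ⟩
    parity (inversions N π₁ + inversions N (transpose b a))
      ≡⟨ parity-+-cong (inversions N π₁) (inversions N (transpose b a)) (N + OrbitChoice.orbits orbitChoice₁) 1 (by-moved k π₁ (ℕ.≤-pred (ℕ.≤-trans moved₁<moved bound)) π₁-inj orbitChoice₁)
                       (parity-inversions-transpose N (a≢b ∘ sym)) ⟩
    parity ((N + OrbitChoice.orbits orbitChoice₁) + 1)
      ≡⟨ cong parity (trans (cong (λ o → N + o + 1) orbits₁) (shuffle N (OrbitChoice.orbits O))) ⟩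
    parity ((N + OrbitChoice.orbits O) + (1 + 1))
      ≡⟨ parity-+-double (N + OrbitChoice.orbits O) 1 ⟩
    parity (N + OrbitChoice.orbits O) ∎
    where
    open ≡-Reasoning
    open SplitOff π π-inj O a (λ πa≡a → contradiction (trans (sym moves-a) (cong not (dec-true (π a ≟ a) πa≡a))) λ ())
    shuffle : ∀ m n → m + suc n + 1 ≡ m + n + (1 + 1)
    shuffle = solve-∀

parity-orbits-∘ : ∀ N (σ α α⁻¹ φ : Fin N → Fin N) → Injective _≡_ _≡_ σ →
  (∀ x → α⁻¹ (α x) ≡ x) → (∀ y → α (α⁻¹ y) ≡ y) → (∀ x → φ x ≡ σ (α x)) →
  (Oσ : OrbitChoice N σ) (Oα : OrbitChoice N α) (Oφ : OrbitChoice N φ) →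
  parity (N + OrbitChoice.orbits Oφ) ≡
  parity ((N + OrbitChoice.orbits Oσ) + (N + OrbitChoice.orbits Oα))
parity-orbits-∘ N σ α α⁻¹ φ σ-inj α⁻¹α αα⁻¹ φ≗σ∘α Oσ Oα Oφ = begin
  parity (N + OrbitChoice.orbits Oφ)   ≡⟨ parity-inversions-orbits N φ φ-inj Oφ ⟨
  parity (inversions N φ)              ≡⟨ cong parity (inversions-cong N φ (σ ∘ α) φ≗σ∘α) ⟩
  parity (inversions N (σ ∘ α))        ≡⟨ parity-inversions-∘ N σ α α⁻¹ σ-inj α⁻¹α αα⁻¹ ⟩
  parity (inversions N σ + inversions N α)
    ≡⟨ parity-+-cong (inversions N σ) (inversions N α) (N + OrbitChoice.orbits Oσ) (N + OrbitChoice.orbits Oα)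
         (parity-inversions-orbits N σ σ-inj Oσ) (parity-inversions-orbits N α α-inj Oα) ⟩
  parity ((N + OrbitChoice.orbits Oσ) + (N + OrbitChoice.orbits Oα)) ∎
  where
  open ≡-Reasoning
  α-inj : Injective _≡_ _≡_ α
  α-inj {x} {y} αx≡αy = trans (sym (α⁻¹α x)) (trans (cong α⁻¹ αx≡αy) (α⁻¹α y))
  φ-inj : Injective _≡_ _≡_ φ
  φ-inj {x} {y} φx≡φy = α-inj (σ-inj (trans (sym (φ≗σ∘α x)) (trans φx≡φy (φ≗σ∘α y))))

∑-involution : ∀ n (α : Fin n → Fin n) → (∀ x → α (α x) ≡ x) → (∀ x → α x ≢ x) →
  (w : Fin n → ℕ) → (∀ x → w (α x) ≡ w x) →
  ∑[ x < n ] w x ≡ ∑[ x < n ] (if x <ᵇ α x then w x else 0) + ∑[ x < n ] (if x <ᵇ α x then w x else 0)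
∑-involution n α α-invol α-nofix w w-α = begin
  ∑[ x < n ] w x
    ≡⟨ ∑-split n (λ _ → true) (λ x → x <ᵇ α x) w ⟩
  ∑[ x < n ] (if x <ᵇ α x then w x else 0) + ∑[ x < n ] (if not (x <ᵇ α x) then w x else 0)
    ≡⟨ cong (∑[ x < n ] (if x <ᵇ α x then w x else 0) +_) (trans (sum-cong-≗ {n} flip) (∑-reindex n α α α-invol α-invol h)) ⟩
  ∑[ x < n ] (if x <ᵇ α x then w x else 0) + ∑[ x < n ] (if x <ᵇ α x then w x else 0) ∎
  where
  open ≡-Reasoning
  h : Fin n → ℕ
  h x = if x <ᵇ α x then w x else 0
  flip : ∀ x → (if not (x <ᵇ α x) then w x else 0) ≡ h (α x)
  flip x rewrite α-invol x | <ᵇ-connex (α-nofix x ∘ sym) | w-α x = refl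

data CycView : ∀ {m} → Fin (suc m) → Set where
  last : ∀ {m} → CycView (fromℕ m)
  inner : ∀ {m} (j : Fin m) → CycView (inject₁ j)

cycView : ∀ {m} (i : Fin (suc m)) → CycView i
cycView {zero} zero = last
cycView {suc m} zero = inner zero
cycView {suc m} (suc i) with cycView i
... | last = last
... | inner j = inner (suc j)

cyc-fromℕ : ∀ m → cyc (fromℕ m) ≡ zero
cyc-fromℕ zero = refl
cyc-fromℕ (suc m) rewrite cyc-fromℕ m = refl

cyc-inject₁ : ∀ {m} (j : Fin m) → cyc (inject₁ j) ≡ suc j
cyc-inject₁ {suc m} zero = refl
cyc-inject₁ {suc m} (suc j) rewrite cyc-inject₁ j = refl

cyc⁻¹ : ∀ {m} → Fin (suc m) → Fin (suc m)
cyc⁻¹ {m} zero = fromℕ m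
cyc⁻¹ (suc j) = inject₁ j

cyc-cyc⁻¹ : ∀ {m} (i : Fin (suc m)) → cyc (cyc⁻¹ i) ≡ i
cyc-cyc⁻¹ {m} zero = cyc-fromℕ m
cyc-cyc⁻¹ (suc j) = cyc-inject₁ j

cyc⁻¹-cyc : ∀ {m} (i : Fin (suc m)) → cyc⁻¹ (cyc i) ≡ i
cyc⁻¹-cyc i with cycView i
... | last = cong cyc⁻¹ (cyc-fromℕ _)
... | inner j = cong cyc⁻¹ (cyc-inject₁ j)

cyc-injective : ∀ {m} {i j : Fin (suc m)} → cyc i ≡ cyc j → i ≡ j
cyc-injective {i = i} {j} eq = trans (sym (cyc⁻¹-cyc i)) (trans (cong cyc⁻¹ eq) (cyc⁻¹-cyc j))

cyc-induction : ∀ {m} (P : Fin (suc m) → Set) → P zero → (∀ i → P i → P (cyc i)) → ∀ i → P i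
cyc-induction P P₀ P-cyc = <-weakInduction P P₀ (λ j P-j → subst P (cyc-inject₁ j) (P-cyc (inject₁ j) P-j))

-- The inside of a simple cycle

module InsideOfCycle (M : PlaneBipartiteMap) (m : ℕ) (γ : Fin (suc m) → Fin (PlaneBipartiteMap.nD M))
  (simple : IsSimpleCycle M m γ) (inside : Fin (PlaneBipartiteMap.nF M) → Bool)
  (interior : IsInterior M γ inside) where

  open PlaneBipartiteMap M
  open IsSimpleCycle simple
  open IsInterior interior

  φ : Fin nD → Fin nD
  φ x = σ (α x)

  φ⁻¹ : Fin nD → Fin nD
  φ⁻¹ y = α (σ⁻ y)

  φ-φ⁻¹ : ∀ y → φ (φ⁻¹ y) ≡ y
  φ-φ⁻¹ y = trans (cong σ (α-invol (σ⁻ y))) (σσ⁻ y)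

  φ⁻¹-φ : ∀ x → φ⁻¹ (φ x) ≡ x
  φ⁻¹-φ x = trans (cong α (σ⁻σ (α x))) (α-invol x)

  face-φ : ∀ x → face (φ x) ≡ face x
  face-φ x = face-orbit₂ x 1

  tail-σ : ∀ x → tail (σ x) ≡ tail x
  tail-σ x = tail-orbit₂ x 1

  face-σ : ∀ x → face (σ x) ≡ face (α x)
  face-σ x = trans (cong (face ∘ σ) (sym (α-invol x))) (face-φ (α x))

  In : Fin nD → Bool
  In x = inside (face x)

  Γ : Fin nD → Bool
  Γ = inCycle M γ

  Γᵛ : Fin nV → Bool
  Γᵛ = onCycle M γ

  In-φ : ∀ x → In (φ x) ≡ In x
  In-φ x = cong inside (face-φ x)

  In-σ : ∀ x → In (σ x) ≡ In (α x)
  In-σ x = cong inside (face-σ x)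

  Γ-α : ∀ x → Γ (α x) ≡ Γ x
  Γ-α x = anyFin-cong (suc m) _ _ λ i →
    trans (cong (λ z → does (γ i ≟ α x) ∨ does (γ i ≟ z)) (α-invol x)) (∨-comm (does (γ i ≟ α x)) _)

  In-α-off : ∀ x → Γ x ≡ false → In (α x) ≡ In x
  In-α-off x off = sym (same x off)

  In-α-on : ∀ x → Γ x ≡ true → In (α x) ≡ not (In x)
  In-α-on x on = ¬-not (cross x on ∘ sym)

  Γ-cases : ∀ x → Γ x ≡ true → Σ (Fin (suc m)) λ i → γ i ≡ x ⊎ x ≡ α (γ i)
  Γ-cases x on with anyFin-witness (suc m) _ on
  ... | i , hit with ∨-true hit
  ...   | inj₁ γi≡x = i , inj₁ (does-true (γ i ≟ x) γi≡x)
  ...   | inj₂ γi≡αx = i , inj₂ (trans (sym (α-invol x)) (cong α (sym (does-true (γ i ≟ α x) γi≡αx))))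

  Γ-γ : ∀ i → Γ (γ i) ≡ true
  Γ-γ i = anyFin-intro (suc m) _ i (cong (_∨ does (γ i ≟ α (γ i))) (dec-true (γ i ≟ γ i) refl))

  Γ-αγ : ∀ i → Γ (α (γ i)) ≡ true
  Γ-αγ i = trans (Γ-α (γ i)) (Γ-γ i)

  Γᵛ-γ : ∀ i → Γᵛ (tail (γ i)) ≡ true
  Γᵛ-γ i = anyFin-intro (suc m) _ i (dec-true (tail (γ i) ≟ tail (γ i)) refl)

  Γᵛ-tail : ∀ x → Γ x ≡ true → Γᵛ (tail x) ≡ true
  Γᵛ-tail x on with Γ-cases x on
  ... | i , inj₁ refl = Γᵛ-γ i
  ... | i , inj₂ refl = subst (λ v → Γᵛ v ≡ true) (sym (consecutive i)) (Γᵛ-γ (cyc i))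

  Γᵛ-cases : ∀ v → Γᵛ v ≡ true → Σ (Fin (suc m)) λ i → tail (γ i) ≡ v
  Γᵛ-cases v on with anyFin-witness (suc m) _ on
  ... | i , hit = i , does-true (tail (γ i) ≟ v) hit

  Γ-off-γ : ∀ x → Γᵛ (tail x) ≡ false → Γ x ≡ false
  Γ-off-γ x off with Γ x in on
  ... | false = refl
  ... | true = contradiction (trans (sym (Γᵛ-tail x on)) off) λ ()

  Γ-at-γ : ∀ i y → Γ y ≡ true → tail y ≡ tail (γ (cyc i)) → y ≡ γ (cyc i) ⊎ y ≡ α (γ i)
  Γ-at-γ i y on tail-y with Γ-cases y on
  ... | j , inj₁ refl = inj₁ (cong γ (distinct-vertices j (cyc i) tail-y))
  ... | j , inj₂ refl = inj₂ (cong (α ∘ γ) (cyc-injective (distinct-vertices (cyc j) (cyc i) (trans (sym (consecutive j)) tail-y))))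

  first-Γ-dart : ∀ k w y → iter σ k w ≡ y → Γ y ≡ true →
    Σ (Fin nD) λ z → Γ z ≡ true × tail z ≡ tail w × In z ≡ In w
  first-Γ-dart k w y σᵏw≡y on-y with Γ w in on-w
  ... | true = w , on-w , refl , refl
  first-Γ-dart zero w y σᵏw≡y on-y | false = contradiction (trans (sym on-y) (trans (cong Γ (sym σᵏw≡y)) on-w)) λ ()
  first-Γ-dart (suc k) w y σᵏw≡y on-y | false with first-Γ-dart k (σ w) y (trans (sym (iter-suc σ k w)) σᵏw≡y) on-y
  ... | z , on-z , tail-z , In-z = z , on-z , trans tail-z (tail-σ w) , trans In-z (trans (In-σ w) (In-α-off w on-w))

  -- Rotating around tail (γ (cyc i)) from σ (γ (cyc i)), In only changes when a dart of γ is crossed,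
  -- and the first dart of γ met is α (γ i).
  In-γ-cyc : ∀ i → In (γ (cyc i)) ≡ In (γ i)
  In-γ-cyc i with tail-orbit₁ (σ (γ (cyc i))) (α (γ i)) (trans (tail-σ (γ (cyc i))) (sym (consecutive i)))
  ... | k , σᵏ≡ with first-Γ-dart k (σ (γ (cyc i))) (α (γ i)) σᵏ≡ (Γ-αγ i)
  ...   | z , on-z , tail-z , In-z with Γ-at-γ i z on-z (trans tail-z (tail-σ (γ (cyc i))))
  ...     | inj₁ refl = contradiction (trans In-z (trans (In-σ _) (In-α-on _ (Γ-γ (cyc i))))) (not-¬ refl)
  ...     | inj₂ refl = sym (not-injective (trans (sym (In-α-on _ (Γ-γ i))) (trans In-z (trans (In-σ _) (In-α-on _ (Γ-γ (cyc i)))))))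

  insideOnRight : Bool
  insideOnRight = In (γ zero)

  In-γ : ∀ i → In (γ i) ≡ insideOnRight
  In-γ = cyc-induction (λ i → In (γ i) ≡ insideOnRight) refl (λ i In-γi → trans (In-γ-cyc i) In-γi)

  γin : Fin (suc m) → Fin nD
  γin i = if insideOnRight then γ i else α (γ i)

  start : Fin (suc m) → Fin (suc m)
  start i = if insideOnRight then i else cyc i

  γin-cases : ∀ {ℓ} (P : Fin nD → Fin (suc m) → Set ℓ) →
    (insideOnRight ≡ true → ∀ i → P (γ i) i) → (insideOnRight ≡ false → ∀ i → P (α (γ i)) (cyc i)) →
    ∀ i → P (γin i) (start i)
  γin-cases P right left i with insideOnRight
  ... | true = right refl i
  ... | false = left refl i

  γin-right : insideOnRight ≡ true → ∀ i → γin i ≡ γ i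
  γin-right o i = cong (if_then γ i else α (γ i)) o

  γin-left : insideOnRight ≡ false → ∀ i → γin i ≡ α (γ i)
  γin-left o i = cong (if_then γ i else α (γ i)) o

  In-γin : ∀ i → In (γin i) ≡ true
  In-γin = γin-cases (λ x _ → In x ≡ true) (λ o i → trans (In-γ i) o)
    (λ o i → trans (In-α-on _ (Γ-γ i)) (cong not (trans (In-γ i) o)))

  Γ-γin : ∀ i → Γ (γin i) ≡ true
  Γ-γin = γin-cases (λ x _ → Γ x ≡ true) (λ _ → Γ-γ) (λ _ → Γ-αγ)

  tail-γin : ∀ i → tail (γin i) ≡ tail (γ (start i))
  tail-γin = γin-cases (λ x j → tail x ≡ tail (γ j)) (λ _ _ → refl) (λ _ → consecutive)

  start-injective : ∀ {i j} → start i ≡ start j → i ≡ j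
  start-injective with insideOnRight
  ... | true = λ eq → eq
  ... | false = cyc-injective

  start-surjective : ∀ j → Σ (Fin (suc m)) λ i → start i ≡ j
  start-surjective j with insideOnRight
  ... | true = j , refl
  ... | false = cyc⁻¹ j , cyc-cyc⁻¹ j

  γin-injective-tail : ∀ {i j} → tail (γin i) ≡ tail (γin j) → i ≡ j
  γin-injective-tail {i} {j} eq =
    start-injective (distinct-vertices (start i) (start j) (trans (sym (tail-γin i)) (trans eq (tail-γin j))))

  γin-injective : ∀ {i j} → γin i ≡ γin j → i ≡ j
  γin-injective = γin-injective-tail ∘ cong tail

  γin-surjective : ∀ x → Γ x ≡ true → In x ≡ true → Σ (Fin (suc m)) λ i → γin i ≡ x
  γin-surjective x on In-x with Γ-cases x on | insideOnRight in o
  ... | i , inj₁ refl | true = i , refl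
  ... | i , inj₁ refl | false = contradiction (trans (sym In-x) (trans (In-γ i) o)) λ ()
  ... | i , inj₂ refl | true = contradiction (trans (sym In-x) (trans (In-α-on _ (Γ-γ i)) (cong not (trans (In-γ i) o)))) λ ()
  ... | i , inj₂ refl | false = i , refl

  In-Γ-unique : ∀ {y y′} → Γ y ≡ true → In y ≡ true → Γ y′ ≡ true → In y′ ≡ true → tail y ≡ tail y′ → y ≡ y′
  In-Γ-unique {y} {y′} on In-y on′ In-y′ tail-y with γin-surjective y on In-y | γin-surjective y′ on′ In-y′
  ... | i , refl | j , refl = cong γin (γin-injective-tail tail-y)

  γin-at : ∀ v → Γᵛ v ≡ true → Σ (Fin (suc m)) λ i → tail (γin i) ≡ v
  γin-at v on with Γᵛ-cases v on
  ... | j , refl with start-surjective j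
  ...   | i , refl = i , tail-γin i

  In-rotate-off-γ : ∀ k x → Γᵛ (tail x) ≡ false → In (iter σ k x) ≡ In x
  In-rotate-off-γ zero x off = refl
  In-rotate-off-γ (suc k) x off = begin
    In (iter σ (suc k) x)  ≡⟨ cong In (iter-suc σ k x) ⟩
    In (iter σ k (σ x))    ≡⟨ In-rotate-off-γ k (σ x) (trans (cong Γᵛ (tail-σ x)) off) ⟩
    In (σ x)               ≡⟨ In-σ x ⟩
    In (α x)               ≡⟨ In-α-off x (Γ-off-γ x off) ⟩
    In x                   ∎
    where open ≡-Reasoning

  In-at-vertex-off-γ : ∀ x y → Γᵛ (tail x) ≡ false → tail x ≡ tail y → In y ≡ In x
  In-at-vertex-off-γ x y off tail-x with tail-orbit₁ x y tail-x
  ... | k , refl = In-rotate-off-γ k x off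

  -- Cutting the map open along γ and keeping its inside: α-cut fixes the darts of γ, φ-cut turns
  -- only around inside faces, and σ-cut = φ-cut ∘ α-cut is the induced rotation.
  α-cut : Fin nD → Fin nD
  α-cut x = if Γ x then x else α x

  φ-cut : Fin nD → Fin nD
  φ-cut x = if In x then φ x else x

  φ-cut⁻¹ : Fin nD → Fin nD
  φ-cut⁻¹ y = if In y then φ⁻¹ y else y

  σ-cut : Fin nD → Fin nD
  σ-cut x = φ-cut (α-cut x)

  α-cut-on : ∀ {x} → Γ x ≡ true → α-cut x ≡ x
  α-cut-on {x} on = cong (if_then x else α x) on

  α-cut-off : ∀ {x} → Γ x ≡ false → α-cut x ≡ α x
  α-cut-off {x} off = cong (if_then x else α x) off

  α-cut-involutive : ∀ x → α-cut (α-cut x) ≡ x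
  α-cut-involutive x = bool-cases (Γ x) (λ on → trans (cong α-cut (α-cut-on on)) (α-cut-on on))
    (λ off → trans (cong α-cut (α-cut-off off)) (trans (α-cut-off (trans (Γ-α x) off)) (α-invol x)))

  In-α-cut : ∀ x → In (α-cut x) ≡ In x
  In-α-cut x = bool-cases (Γ x) (λ on → cong In (α-cut-on on)) (λ off → trans (cong In (α-cut-off off)) (In-α-off x off))

  φ-cut-in : ∀ {x} → In x ≡ true → φ-cut x ≡ φ x
  φ-cut-in {x} in′ = cong (if_then φ x else x) in′

  φ-cut-out : ∀ {x} → In x ≡ false → φ-cut x ≡ x
  φ-cut-out {x} out = cong (if_then φ x else x) out

  In-φ-cut : ∀ x → In (φ-cut x) ≡ In x
  In-φ-cut x = bool-cases (In x) (λ in′ → trans (cong In (φ-cut-in in′)) (In-φ x)) (λ out → cong In (φ-cut-out out))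

  φ-cut⁻¹-φ-cut : ∀ x → φ-cut⁻¹ (φ-cut x) ≡ x
  φ-cut⁻¹-φ-cut x = bool-cases (In x)
    (λ in′ → trans (cong φ-cut⁻¹ (φ-cut-in in′))
      (trans (cong (if_then φ⁻¹ (φ x) else φ x) (trans (In-φ x) in′)) (φ⁻¹-φ x)))
    (λ out → trans (cong φ-cut⁻¹ (φ-cut-out out)) (cong (if_then φ⁻¹ x else x) out))

  σ-cut-injective : Injective _≡_ _≡_ σ-cut
  σ-cut-injective {x} {y} eq = begin
    x                                         ≡⟨ α-cut-involutive x ⟨
    α-cut (α-cut x)                           ≡⟨ cong α-cut (φ-cut⁻¹-φ-cut (α-cut x)) ⟨
    α-cut (φ-cut⁻¹ (φ-cut (α-cut x)))         ≡⟨ cong (α-cut ∘ φ-cut⁻¹) eq ⟩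
    α-cut (φ-cut⁻¹ (φ-cut (α-cut y)))         ≡⟨ cong α-cut (φ-cut⁻¹-φ-cut (α-cut y)) ⟩
    α-cut (α-cut y)                           ≡⟨ α-cut-involutive y ⟩
    y                                         ∎
    where open ≡-Reasoning

  σ-cut-in-on : ∀ {x} → In x ≡ true → Γ x ≡ true → σ-cut x ≡ σ (α x)
  σ-cut-in-on in′ on = trans (cong φ-cut (α-cut-on on)) (φ-cut-in in′)

  σ-cut-in-off : ∀ {x} → In x ≡ true → Γ x ≡ false → σ-cut x ≡ σ x
  σ-cut-in-off {x} in′ off = trans (cong φ-cut (α-cut-off off))
    (trans (φ-cut-in (trans (In-α-off x off) in′)) (cong σ (α-invol x)))

  σ-cut-out : ∀ {x} → In x ≡ false → σ-cut x ≡ α-cut x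
  σ-cut-out {x} out = φ-cut-out (trans (In-α-cut x) out)

  In-σ-cut : ∀ x → In (σ-cut x) ≡ In x
  In-σ-cut x = trans (In-φ-cut (α-cut x)) (In-α-cut x)

  φ-cut≗σ-cut∘α-cut : ∀ x → φ-cut x ≡ σ-cut (α-cut x)
  φ-cut≗σ-cut∘α-cut x = cong φ-cut (sym (α-cut-involutive x))

  edgeRep : Fin nD → Fin nD
  edgeRep x = if x <ᵇ α x then x else α x

  <ᵇ-α-flip : ∀ x → (α x <ᵇ α (α x)) ≡ not (x <ᵇ α x)
  <ᵇ-α-flip x = trans (cong (α x <ᵇ_) (α-invol x)) (<ᵇ-connex (α-nofix x ∘ sym))

  edgeRep-cases : ∀ x → edgeRep x ≡ x × (x <ᵇ α x) ≡ true ⊎ edgeRep x ≡ α x × (x <ᵇ α x) ≡ false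
  edgeRep-cases x with x <ᵇ α x
  ... | true = inj₁ (refl , refl)
  ... | false = inj₂ (refl , refl)

  edgeRep-α : ∀ x → edgeRep (α x) ≡ edgeRep x
  edgeRep-α x with edgeRep-cases x | edgeRep-cases (α x)
  ... | inj₁ (e , x<αx) | inj₁ (_ , αx<ααx) = contradiction (trans (sym αx<ααx) (trans (<ᵇ-α-flip x) (cong not x<αx))) λ ()
  ... | inj₁ (e , _) | inj₂ (e′ , _) = trans e′ (trans (α-invol x) (sym e))
  ... | inj₂ (e , _) | inj₁ (e′ , _) = trans e′ (sym e)
  ... | inj₂ (e , x≮αx) | inj₂ (_ , αx≮ααx) = contradiction (trans (sym (cong not x≮αx)) (trans (sym (<ᵇ-α-flip x)) αx≮ααx)) λ ()

  edgeRep-idempotent : ∀ x → edgeRep (edgeRep x) ≡ edgeRep x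
  edgeRep-idempotent x with edgeRep-cases x
  ... | inj₁ (e , _) = cong edgeRep e
  ... | inj₂ (e , _) = trans (cong edgeRep e) (edgeRep-α x)

  edgeRep-same-edge : ∀ x y → edgeRep x ≡ edgeRep y → y ≡ x ⊎ y ≡ α x
  edgeRep-same-edge x y eq with edgeRep-cases x | edgeRep-cases y
  ... | inj₁ (p , _) | inj₁ (q , _) = inj₁ (trans (sym q) (trans (sym eq) p))
  ... | inj₁ (p , _) | inj₂ (q , _) = inj₂ (trans (sym (α-invol y)) (cong α (trans (sym q) (trans (sym eq) p))))
  ... | inj₂ (p , _) | inj₁ (q , _) = inj₂ (trans (sym q) (trans (sym eq) p))
  ... | inj₂ (p , _) | inj₂ (q , _) = inj₁ (trans (sym (α-invol y)) (trans (cong α (trans (sym q) (trans (sym eq) p))) (α-invol x)))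

  edgeRep-fixed : ∀ x → does (edgeRep x ≟ x) ≡ (x <ᵇ α x)
  edgeRep-fixed x with edgeRep-cases x
  ... | inj₁ (e , x<αx) = trans (dec-true (edgeRep x ≟ x) e) (sym x<αx)
  ... | inj₂ (e , x≮αx) = trans (dec-false (edgeRep x ≟ x) (α-nofix x ∘ trans (sym e))) (sym x≮αx)

  Γ-edgeRep : ∀ x → Γ (edgeRep x) ≡ Γ x
  Γ-edgeRep x with edgeRep-cases x
  ... | inj₁ (e , _) = cong Γ e
  ... | inj₂ (e , _) = trans (cong Γ e) (Γ-α x)

  In-edgeRep : ∀ x → Γ x ≡ false → In (edgeRep x) ≡ In x
  In-edgeRep x off with edgeRep-cases x
  ... | inj₁ (e , _) = cong In e
  ... | inj₂ (e , _) = trans (cong In e) (In-α-off x off)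

  α-rep : Fin nD → Fin nD
  α-rep x = if Γ x then x else edgeRep x

  α-rep-on : ∀ {x} → Γ x ≡ true → α-rep x ≡ x
  α-rep-on {x} on = cong (if_then x else edgeRep x) on

  α-rep-off : ∀ {x} → Γ x ≡ false → α-rep x ≡ edgeRep x
  α-rep-off {x} off = cong (if_then x else edgeRep x) off

  In-α-rep : ∀ x → In (α-rep x) ≡ In x
  In-α-rep x = bool-cases (Γ x) (λ on → cong In (α-rep-on on)) (λ off → trans (cong In (α-rep-off off)) (In-edgeRep x off))

  α-cut-orbits : OrbitChoice nD α-cut
  α-cut-orbits = record
    { rep = α-rep
    ; rep-invariant = λ x → bool-cases (Γ x) (λ on → cong α-rep (α-cut-on on))
        (λ off → trans (cong α-rep (α-cut-off off)) (trans (α-rep-off (trans (Γ-α x) off))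
                   (trans (edgeRep-α x) (sym (α-rep-off off)))))
    ; rep-reaches = reaches
    ; rep-idempotent = λ x → bool-cases (Γ x) (λ on → cong α-rep (α-rep-on on))
        (λ off → trans (cong α-rep (α-rep-off off)) (trans (α-rep-off (trans (Γ-edgeRep x) off))
                   (trans (edgeRep-idempotent x) (sym (α-rep-off off)))))
    }
    where
    reaches : ∀ x y → α-rep x ≡ α-rep y → Reaches α-cut x y
    reaches x y eq = bool-cases (Γ x)
      (λ Γx → bool-cases (Γ y)
        (λ Γy → 0 , trans (sym (α-rep-on Γx)) (trans eq (α-rep-on Γy)))
        (λ Γy → contradiction (trans (sym Γx) (trans (cong Γ (trans (sym (α-rep-on Γx)) (trans eq (α-rep-off Γy))))
                   (trans (Γ-edgeRep y) Γy))) λ ()))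
      (λ Γx → bool-cases (Γ y)
        (λ Γy → contradiction (trans (sym Γy) (trans (cong Γ (trans (sym (α-rep-on Γy)) (trans (sym eq) (α-rep-off Γx))))
                   (trans (Γ-edgeRep x) Γx))) λ ())
        (λ Γy → same-edge Γx (edgeRep-same-edge x y (trans (sym (α-rep-off Γx)) (trans eq (α-rep-off Γy))))))
      where
      same-edge : Γ x ≡ false → y ≡ x ⊎ y ≡ α x → Reaches α-cut x y
      same-edge _ (inj₁ y≡x) = 0 , sym y≡x
      same-edge Γx (inj₂ y≡αx) = 1 , trans (α-cut-off Γx) (sym y≡αx)

  faceRep : Fin nF → Fin nD
  faceRep f = proj₁ (face-surj f)

  face-faceRep : ∀ f → face (faceRep f) ≡ f
  face-faceRep f = proj₂ (face-surj f)

  φ-rep : Fin nD → Fin nD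
  φ-rep x = if In x then faceRep (face x) else x

  φ-rep-in : ∀ {x} → In x ≡ true → φ-rep x ≡ faceRep (face x)
  φ-rep-in {x} in′ = cong (if_then faceRep (face x) else x) in′

  φ-rep-out : ∀ {x} → In x ≡ false → φ-rep x ≡ x
  φ-rep-out {x} out = cong (if_then faceRep (face x) else x) out

  In-faceRep : ∀ x → In (faceRep (face x)) ≡ In x
  In-faceRep x = cong inside (face-faceRep (face x))

  φ-cut-orbits : OrbitChoice nD φ-cut
  φ-cut-orbits = record
    { rep = φ-rep
    ; rep-invariant = λ x → bool-cases (In x)
        (λ in′ → trans (cong φ-rep (φ-cut-in in′)) (trans (φ-rep-in (trans (In-φ x) in′))
                   (trans (cong faceRep (face-φ x)) (sym (φ-rep-in in′)))))
        (λ out → cong φ-rep (φ-cut-out out))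
    ; rep-reaches = reaches
    ; rep-idempotent = λ x → bool-cases (In x)
        (λ in′ → trans (cong φ-rep (φ-rep-in in′)) (trans (φ-rep-in (trans (In-faceRep x) in′))
                   (trans (cong faceRep (face-faceRep (face x))) (sym (φ-rep-in in′)))))
        (λ out → cong φ-rep (φ-rep-out out))
    }
    where
    reaches : ∀ x y → φ-rep x ≡ φ-rep y → Reaches φ-cut x y
    reaches x y eq = bool-cases (In x)
      (λ In-x → bool-cases (In y)
        (λ In-y → same-face In-x (trans (sym (face-faceRep (face x)))
          (trans (cong face (trans (sym (φ-rep-in In-x)) (trans eq (φ-rep-in In-y)))) (face-faceRep (face y)))))
        (λ In-y → contradiction (trans (sym In-x) (trans (sym (In-faceRep x))
          (trans (cong In (trans (sym (φ-rep-in In-x)) (trans eq (φ-rep-out In-y)))) In-y))) λ ()))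
      (λ In-x → bool-cases (In y)
        (λ In-y → contradiction (trans (sym In-y) (trans (sym (In-faceRep y))
          (trans (cong In (trans (sym (φ-rep-in In-y)) (trans (sym eq) (φ-rep-out In-x)))) In-x))) λ ())
        (λ In-y → 0 , trans (sym (φ-rep-out In-x)) (trans eq (φ-rep-out In-y))))
      where
      same-face : In x ≡ true → face x ≡ face y → Reaches φ-cut x y
      same-face In-x face-x with face-orbit₁ x y face-x
      ... | k , φᵏx≡y = k , trans (iter-agree In φ-cut φ (λ z → φ-cut-in) (λ z in′ → trans (In-φ-cut z) in′) k x In-x) φᵏx≡y

  reaches-at-vertex : ∀ k {x y} → iter σ k x ≡ y → In x ≡ true → Γ y ≡ true → In y ≡ true → Reaches σ-cut x y
  reaches-at-vertex k {x} {y} σᵏx≡y In-x on-y In-y = bool-cases (Γ x)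
    (λ on-x → 0 , In-Γ-unique on-x In-x on-y In-y (trans (sym (tail-orbit₂ x k)) (cong tail σᵏx≡y)))
    (λ off-x → rotate k σᵏx≡y off-x)
    where
    rotate : ∀ k → iter σ k x ≡ y → Γ x ≡ false → Reaches σ-cut x y
    rotate zero x≡y off-x = contradiction (trans (sym on-y) (trans (cong Γ (sym x≡y)) off-x)) λ ()
    rotate (suc k) σᵏx≡y off-x = reaches-step σ-cut (subst (λ z → Reaches σ-cut z y) (sym (σ-cut-in-off In-x off-x))
      (reaches-at-vertex k (trans (sym (iter-suc σ k x)) σᵏx≡y) (trans (In-σ x) (trans (In-α-off x off-x) In-x)) on-y In-y))

  reaches-γin-at-vertex : ∀ {x} i → In x ≡ true → tail x ≡ tail (γin i) → Reaches σ-cut x (γin i)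
  reaches-γin-at-vertex {x} i In-x tail-x with tail-orbit₁ x (γin i) tail-x
  ... | k , σᵏx≡γin = reaches-at-vertex k σᵏx≡γin In-x (Γ-γin i) (In-γin i)

  reaches-next-γin : ∀ i j → tail (α (γin i)) ≡ tail (γin j) → Reaches σ-cut (γin i) (γin j)
  reaches-next-γin i j tail-eq = reaches-step σ-cut (subst (λ z → Reaches σ-cut z (γin j))
    (sym (σ-cut-in-on (In-γin i) (Γ-γin i)))
    (reaches-γin-at-vertex j (trans (In-σ _) (trans (cong In (α-invol (γin i))) (In-γin i)))
      (trans (tail-σ _) tail-eq)))

  γin-connected : ∀ i → Reaches σ-cut (γin i) (γin zero)
  γin-connected = cyc-induction (λ i → Reaches σ-cut (γin i) (γin zero)) (reaches-refl σ-cut)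
    (λ i i⇝0 → reaches-trans σ-cut (back i) i⇝0)
    where
    back : ∀ i → Reaches σ-cut (γin (cyc i)) (γin i)
    back i = bool-cases insideOnRight
      (λ o → reaches-sym σ-cut σ-cut-injective (reaches-next-γin i (cyc i) (begin
        tail (α (γin i))      ≡⟨ cong (tail ∘ α) (γin-right o i) ⟩
        tail (α (γ i))        ≡⟨ consecutive i ⟩
        tail (γ (cyc i))      ≡⟨ cong tail (γin-right o (cyc i)) ⟨
        tail (γin (cyc i))    ∎)))
      (λ o → reaches-next-γin (cyc i) i (begin
        tail (α (γin (cyc i)))      ≡⟨ cong (tail ∘ α) (γin-left o (cyc i)) ⟩
        tail (α (α (γ (cyc i))))    ≡⟨ cong tail (α-invol (γ (cyc i))) ⟩
        tail (γ (cyc i))            ≡⟨ consecutive i ⟨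
        tail (α (γ i))              ≡⟨ cong tail (γin-left o i) ⟨
        tail (γin i)                ∎))
      where open ≡-Reasoning

  reaches-γin-zero : ∀ x → In x ≡ true → Γᵛ (tail x) ≡ true → Reaches σ-cut x (γin zero)
  reaches-γin-zero x In-x on with γin-at (tail x) on
  ... | i , tail-γin-i = reaches-trans σ-cut (reaches-γin-at-vertex i In-x (sym tail-γin-i)) (γin-connected i)

  vertexRep : Fin nV → Fin nD
  vertexRep v = proj₁ (tail-surj v)

  tail-vertexRep : ∀ v → tail (vertexRep v) ≡ v
  tail-vertexRep v = proj₂ (tail-surj v)

  -- all inside darts at vertices of γ form a single σ-cut orbit, represented by γin zero
  vertexOrbitRep : Fin nD → Fin nD
  vertexOrbitRep x = if Γᵛ (tail x) then γin zero else vertexRep (tail x)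

  vertexOrbitRep-on : ∀ {x} → Γᵛ (tail x) ≡ true → vertexOrbitRep x ≡ γin zero
  vertexOrbitRep-on {x} on = cong (if_then γin zero else vertexRep (tail x)) on

  vertexOrbitRep-off : ∀ {x} → Γᵛ (tail x) ≡ false → vertexOrbitRep x ≡ vertexRep (tail x)
  vertexOrbitRep-off {x} off = cong (if_then γin zero else vertexRep (tail x)) off

  Γᵛ-γin-zero : Γᵛ (tail (γin zero)) ≡ true
  Γᵛ-γin-zero = Γᵛ-tail (γin zero) (Γ-γin zero)

  In-vertexOrbitRep : ∀ x → In x ≡ true → In (vertexOrbitRep x) ≡ true
  In-vertexOrbitRep x In-x = bool-cases (Γᵛ (tail x))
    (λ on → trans (cong In (vertexOrbitRep-on on)) (In-γin zero))
    (λ off → trans (cong In (vertexOrbitRep-off off))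
      (trans (In-at-vertex-off-γ x (vertexRep (tail x)) off (sym (tail-vertexRep (tail x)))) In-x))

  vertexOrbitRep-σ-cut : ∀ x → In x ≡ true → vertexOrbitRep (σ-cut x) ≡ vertexOrbitRep x
  vertexOrbitRep-σ-cut x In-x = bool-cases (Γ x)
    (λ on → trans (vertexOrbitRep-on (trans (cong (Γᵛ ∘ tail) (σ-cut-in-on In-x on))
                    (trans (cong Γᵛ (tail-σ (α x))) (Γᵛ-tail (α x) (trans (Γ-α x) on)))))
                  (sym (vertexOrbitRep-on (Γᵛ-tail x on))))
    (λ off → trans (cong vertexOrbitRep (σ-cut-in-off In-x off))
                   (cong (λ v → if Γᵛ v then γin zero else vertexRep v) (tail-σ x)))

  vertexOrbitRep-idempotent : ∀ x → vertexOrbitRep (vertexOrbitRep x) ≡ vertexOrbitRep x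
  vertexOrbitRep-idempotent x = bool-cases (Γᵛ (tail x))
    (λ on → trans (cong vertexOrbitRep (vertexOrbitRep-on on))
      (trans (vertexOrbitRep-on Γᵛ-γin-zero) (sym (vertexOrbitRep-on on))))
    (λ off → trans (cong vertexOrbitRep (vertexOrbitRep-off off))
      (trans (vertexOrbitRep-off (trans (cong Γᵛ (tail-vertexRep (tail x))) off))
      (trans (cong vertexRep (tail-vertexRep (tail x))) (sym (vertexOrbitRep-off off)))))

  σ-rep : Fin nD → Fin nD
  σ-rep x = if In x then vertexOrbitRep x else α-rep x

  σ-rep-in : ∀ {x} → In x ≡ true → σ-rep x ≡ vertexOrbitRep x
  σ-rep-in {x} in′ = cong (if_then vertexOrbitRep x else α-rep x) in′

  σ-rep-out : ∀ {x} → In x ≡ false → σ-rep x ≡ α-rep x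
  σ-rep-out {x} out = cong (if_then vertexOrbitRep x else α-rep x) out

  In-σ-rep : ∀ x → In (σ-rep x) ≡ In x
  In-σ-rep x = bool-cases (In x)
    (λ in′ → trans (cong In (σ-rep-in in′)) (trans (In-vertexOrbitRep x in′) (sym in′)))
    (λ out → trans (cong In (σ-rep-out out)) (In-α-rep x))

  vertexRep-off-γ : ∀ {x} → Γᵛ (tail x) ≡ false → Γᵛ (tail (vertexRep (tail x))) ≡ false
  vertexRep-off-γ {x} off = trans (cong Γᵛ (tail-vertexRep (tail x))) off

  γin-zero≢vertexRep : ∀ {x} → Γᵛ (tail x) ≡ false → γin zero ≢ vertexRep (tail x)
  γin-zero≢vertexRep {x} off eq =
    contradiction (trans (sym Γᵛ-γin-zero) (trans (cong (λ z → Γᵛ (tail z)) eq) (vertexRep-off-γ {x} off))) λ ()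

  σ-rep-reaches-out : ∀ x y → In x ≡ false → α-rep x ≡ α-rep y → Reaches σ-cut x y
  σ-rep-reaches-out x y out eq with OrbitChoice.rep-reaches α-cut-orbits x y eq
  ... | k , αᵏx≡y = k , trans (iter-agree (not ∘ In) σ-cut α-cut (λ z out′ → σ-cut-out (not-true out′))
                                (λ z out′ → trans (cong not (In-σ-cut z)) out′) k x (cong not out)) αᵏx≡y

  σ-rep-reaches-same-vertex : ∀ x y → In x ≡ true → Γᵛ (tail x) ≡ false → tail x ≡ tail y → Reaches σ-cut x y
  σ-rep-reaches-same-vertex x y In-x off-x tail-x with tail-orbit₁ x y tail-x
  ... | k , σᵏx≡y = k , trans (iter-agree S σ-cut σ σ-cut≡σ closed k x (∧-intro In-x (cong not off-x))) σᵏx≡y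
    where
    S : Fin nD → Bool
    S z = In z ∧ not (Γᵛ (tail z))
    σ-cut≡σ : ∀ z → S z ≡ true → σ-cut z ≡ σ z
    σ-cut≡σ z Sz = σ-cut-in-off (proj₁ (∧-true Sz)) (Γ-off-γ z (not-true (proj₂ (∧-true Sz))))
    closed : ∀ z → S z ≡ true → S (σ-cut z) ≡ true
    closed z Sz = ∧-intro (trans (In-σ-cut z) (proj₁ (∧-true Sz)))
      (trans (cong (λ w → not (Γᵛ (tail w))) (σ-cut≡σ z Sz)) (trans (cong (λ v → not (Γᵛ v)) (tail-σ z)) (proj₂ (∧-true Sz))))

  σ-rep-reaches-in : ∀ x y → In x ≡ true → In y ≡ true → vertexOrbitRep x ≡ vertexOrbitRep y → Reaches σ-cut x y
  σ-rep-reaches-in x y In-x In-y eq = bool-cases (Γᵛ (tail x))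
    (λ on-x → bool-cases (Γᵛ (tail y))
      (λ on-y → reaches-trans σ-cut (reaches-γin-zero x In-x on-x)
                                    (reaches-sym σ-cut σ-cut-injective (reaches-γin-zero y In-y on-y)))
      (λ off-y → contradiction (trans (sym (vertexOrbitRep-on on-x)) (trans eq (vertexOrbitRep-off off-y)))
                               (γin-zero≢vertexRep off-y)))
    (λ off-x → bool-cases (Γᵛ (tail y))
      (λ on-y → contradiction (trans (sym (vertexOrbitRep-on on-y)) (trans (sym eq) (vertexOrbitRep-off off-x)))
                              (γin-zero≢vertexRep off-x))
      (λ off-y → σ-rep-reaches-same-vertex x y In-x off-x (begin
        tail x                        ≡⟨ tail-vertexRep (tail x) ⟨
        tail (vertexRep (tail x))     ≡⟨ cong tail (vertexOrbitRep-off off-x) ⟨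
        tail (vertexOrbitRep x)       ≡⟨ cong tail eq ⟩
        tail (vertexOrbitRep y)       ≡⟨ cong tail (vertexOrbitRep-off off-y) ⟩
        tail (vertexRep (tail y))     ≡⟨ tail-vertexRep (tail y) ⟩
        tail y                        ∎)))
    where open ≡-Reasoning

  σ-rep-reaches : ∀ x y → σ-rep x ≡ σ-rep y → Reaches σ-cut x y
  σ-rep-reaches x y eq = bool-cases (In x)
    (λ In-x → σ-rep-reaches-in x y In-x (trans (sym In-x≡In-y) In-x)
      (trans (sym (σ-rep-in In-x)) (trans eq (σ-rep-in (trans (sym In-x≡In-y) In-x)))))
    (λ out → σ-rep-reaches-out x y out
      (trans (sym (σ-rep-out out)) (trans eq (σ-rep-out (trans (sym In-x≡In-y) out)))))
    where
    In-x≡In-y : In x ≡ In y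
    In-x≡In-y = trans (sym (In-σ-rep x)) (trans (cong In eq) (In-σ-rep y))

  σ-cut-orbits : OrbitChoice nD σ-cut
  σ-cut-orbits = record
    { rep = σ-rep
    ; rep-invariant = λ x → bool-cases (In x)
        (λ in′ → trans (σ-rep-in (trans (In-σ-cut x) in′)) (trans (vertexOrbitRep-σ-cut x in′) (sym (σ-rep-in in′))))
        (λ out → trans (σ-rep-out (trans (In-σ-cut x) out))
                   (trans (cong α-rep (σ-cut-out out)) (trans (OrbitChoice.rep-invariant α-cut-orbits x) (sym (σ-rep-out out)))))
    ; rep-reaches = σ-rep-reaches
    ; rep-idempotent = λ x → bool-cases (In x)
        (λ in′ → trans (cong σ-rep (σ-rep-in in′)) (trans (σ-rep-in (In-vertexOrbitRep x in′))
                   (trans (vertexOrbitRep-idempotent x) (sym (σ-rep-in in′)))))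
        (λ out → trans (cong σ-rep (σ-rep-out out)) (trans (σ-rep-out (trans (In-α-rep x) out))
                   (trans (OrbitChoice.rep-idempotent α-cut-orbits x) (sym (σ-rep-out out)))))
    }

  count : (Fin nD → Bool) → ℕ
  count P = ∑[ x < nD ] ⟦ P x ⟧

  insideΓ outsideΓ insideEdges outsideEdges insideFaces insideVertices : ℕ
  insideΓ = count (λ x → In x ∧ Γ x)
  outsideΓ = count (λ x → not (In x) ∧ Γ x)
  insideEdges = count (λ x → (In x ∧ not (Γ x)) ∧ x <ᵇ α x)
  outsideEdges = count (λ x → (not (In x) ∧ not (Γ x)) ∧ x <ᵇ α x)
  insideFaces = count (λ x → In x ∧ does (faceRep (face x) ≟ x))
  insideVertices = count (λ x → In x ∧ (not (Γᵛ (tail x)) ∧ does (vertexRep (tail x) ≟ x)))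

  count-edges : ∀ (T : Fin nD → Bool) → (∀ x → T (α x) ≡ T x) →
    count T ≡ count (λ x → T x ∧ x <ᵇ α x) + count (λ x → T x ∧ x <ᵇ α x)
  count-edges T T-α = trans (∑-involution nD α α-invol α-nofix (⟦_⟧ ∘ T) (cong ⟦_⟧ ∘ T-α))
    (cong₂ _+_ (sum-cong-≗ (λ x → sym (⟦∧⟧≡if (T x) (x <ᵇ α x)))) (sum-cong-≗ (λ x → sym (⟦∧⟧≡if (T x) (x <ᵇ α x)))))

  α-rep-fixed : ∀ x → ⟦ does (α-rep x ≟ x) ⟧ ≡ ⟦ Γ x ⟧ + ⟦ not (Γ x) ∧ x <ᵇ α x ⟧
  α-rep-fixed x = bool-cases (Γ x)
    (λ on → trans (cong (λ z → ⟦ does (z ≟ x) ⟧) (α-rep-on on))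
      (trans (cong ⟦_⟧ (dec-true (x ≟ x) refl)) (cong (λ b → ⟦ b ⟧ + ⟦ not b ∧ x <ᵇ α x ⟧) (sym on))))
    (λ off → trans (cong (λ z → ⟦ does (z ≟ x) ⟧) (α-rep-off off))
      (trans (cong ⟦_⟧ (edgeRep-fixed x)) (cong (λ b → ⟦ b ⟧ + ⟦ not b ∧ x <ᵇ α x ⟧) (sym off))))

  φ-rep-fixed : ∀ x → ⟦ does (φ-rep x ≟ x) ⟧ ≡ ⟦ not (In x) ⟧ + ⟦ In x ∧ does (faceRep (face x) ≟ x) ⟧
  φ-rep-fixed x = bool-cases (In x)
    (λ in′ → trans (cong (λ z → ⟦ does (z ≟ x) ⟧) (φ-rep-in in′))
      (cong (λ b → ⟦ not b ⟧ + ⟦ b ∧ does (faceRep (face x) ≟ x) ⟧) (sym in′)))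
    (λ out → trans (cong (λ z → ⟦ does (z ≟ x) ⟧) (φ-rep-out out))
      (trans (cong ⟦_⟧ (dec-true (x ≟ x) refl)) (cong (λ b → ⟦ not b ⟧ + ⟦ b ∧ does (faceRep (face x) ≟ x) ⟧) (sym out))))

  σ-rep-fixed : ∀ x → ⟦ does (σ-rep x ≟ x) ⟧ ≡
    ⟦ not (In x) ∧ Γ x ⟧ + ⟦ (not (In x) ∧ not (Γ x)) ∧ x <ᵇ α x ⟧ + ⟦ does (γin zero ≟ x) ⟧
    + ⟦ In x ∧ (not (Γᵛ (tail x)) ∧ does (vertexRep (tail x) ≟ x)) ⟧
  σ-rep-fixed x = bool-cases (In x) inside-x outside-x
    where
    outside-x : In x ≡ false → ⟦ does (σ-rep x ≟ x) ⟧ ≡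
      ⟦ not (In x) ∧ Γ x ⟧ + ⟦ (not (In x) ∧ not (Γ x)) ∧ x <ᵇ α x ⟧ + ⟦ does (γin zero ≟ x) ⟧
      + ⟦ In x ∧ (not (Γᵛ (tail x)) ∧ does (vertexRep (tail x) ≟ x)) ⟧
    outside-x out rewrite σ-rep-out out | out | α-rep-fixed x
      | dec-false (γin zero ≟ x) (λ γin≡x → contradiction (trans (sym (In-γin zero)) (trans (cong In γin≡x) out)) λ ())
      = sym (trans (ℕ.+-identityʳ _) (ℕ.+-identityʳ _))
    inside-x : In x ≡ true → ⟦ does (σ-rep x ≟ x) ⟧ ≡
      ⟦ not (In x) ∧ Γ x ⟧ + ⟦ (not (In x) ∧ not (Γ x)) ∧ x <ᵇ α x ⟧ + ⟦ does (γin zero ≟ x) ⟧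
      + ⟦ In x ∧ (not (Γᵛ (tail x)) ∧ does (vertexRep (tail x) ≟ x)) ⟧
    inside-x in′ = bool-cases (Γᵛ (tail x)) on-x off-x
      where
      on-x : Γᵛ (tail x) ≡ true → ⟦ does (σ-rep x ≟ x) ⟧ ≡
        ⟦ not (In x) ∧ Γ x ⟧ + ⟦ (not (In x) ∧ not (Γ x)) ∧ x <ᵇ α x ⟧ + ⟦ does (γin zero ≟ x) ⟧
        + ⟦ In x ∧ (not (Γᵛ (tail x)) ∧ does (vertexRep (tail x) ≟ x)) ⟧
      on-x on rewrite σ-rep-in in′ | vertexOrbitRep-on on | in′ | on = sym (ℕ.+-identityʳ _)
      off-x : Γᵛ (tail x) ≡ false → ⟦ does (σ-rep x ≟ x) ⟧ ≡
        ⟦ not (In x) ∧ Γ x ⟧ + ⟦ (not (In x) ∧ not (Γ x)) ∧ x <ᵇ α x ⟧ + ⟦ does (γin zero ≟ x) ⟧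
        + ⟦ In x ∧ (not (Γᵛ (tail x)) ∧ does (vertexRep (tail x) ≟ x)) ⟧
      off-x off rewrite σ-rep-in in′ | vertexOrbitRep-off off | in′ | off
        | dec-false (γin zero ≟ x) (λ γin≡x → contradiction (trans (sym Γᵛ-γin-zero) (trans (cong (λ z → Γᵛ (tail z)) γin≡x) off)) λ ())
        = refl

  count-In∧¬Γ-α : ∀ x → (In (α x) ∧ not (Γ (α x))) ≡ (In x ∧ not (Γ x))
  count-In∧¬Γ-α x = bool-cases (Γ x)
    (λ on → trans (cong (λ c → In (α x) ∧ not c) (trans (Γ-α x) on))
              (trans (∧-zeroʳ (In (α x))) (sym (trans (cong (λ c → In x ∧ not c) on) (∧-zeroʳ (In x))))))
    (λ off → cong₂ (λ i c → i ∧ not c) (In-α-off x off) (Γ-α x))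

  count-¬In∧¬Γ-α : ∀ x → (not (In (α x)) ∧ not (Γ (α x))) ≡ (not (In x) ∧ not (Γ x))
  count-¬In∧¬Γ-α x = bool-cases (Γ x)
    (λ on → trans (cong (λ c → not (In (α x)) ∧ not c) (trans (Γ-α x) on))
              (trans (∧-zeroʳ (not (In (α x)))) (sym (trans (cong (λ c → not (In x) ∧ not c) on) (∧-zeroʳ (not (In x)))))))
    (λ off → cong₂ (λ i c → not i ∧ not c) (In-α-off x off) (Γ-α x))

  count-inside-off-γ : count (λ x → In x ∧ not (Γ x)) ≡ insideEdges + insideEdges
  count-inside-off-γ = count-edges (λ x → In x ∧ not (Γ x)) count-In∧¬Γ-α

  count-outside-off-γ : count (λ x → not (In x) ∧ not (Γ x)) ≡ outsideEdges + outsideEdges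
  count-outside-off-γ = count-edges (λ x → not (In x) ∧ not (Γ x)) count-¬In∧¬Γ-α

  darts : nD ≡ (insideΓ + outsideΓ) + ((insideEdges + insideEdges) + (outsideEdges + outsideEdges))
  darts = begin
    nD                             ≡⟨ ∑-one nD ⟨
    ∑[ x < nD ] 1                  ≡⟨ sum-cong-≗ (λ x → quarters (In x) (Γ x)) ⟩
    ∑[ x < nD ] ((⟦ In x ∧ Γ x ⟧ + ⟦ not (In x) ∧ Γ x ⟧) + (⟦ In x ∧ not (Γ x) ⟧ + ⟦ not (In x) ∧ not (Γ x) ⟧))
      ≡⟨ ∑-distrib-+₄ (λ x → ⟦ In x ∧ Γ x ⟧) (λ x → ⟦ not (In x) ∧ Γ x ⟧)
                      (λ x → ⟦ In x ∧ not (Γ x) ⟧) (λ x → ⟦ not (In x) ∧ not (Γ x) ⟧) ⟩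
    (insideΓ + outsideΓ) + (count (λ x → In x ∧ not (Γ x)) + count (λ x → not (In x) ∧ not (Γ x)))
      ≡⟨ cong ((insideΓ + outsideΓ) +_) (cong₂ _+_ count-inside-off-γ count-outside-off-γ) ⟩
    (insideΓ + outsideΓ) + ((insideEdges + insideEdges) + (outsideEdges + outsideEdges)) ∎
    where
    open ≡-Reasoning
    quarters : ∀ i c → 1 ≡ (⟦ i ∧ c ⟧ + ⟦ not i ∧ c ⟧) + (⟦ i ∧ not c ⟧ + ⟦ not i ∧ not c ⟧)
    quarters true true = refl
    quarters true false = refl
    quarters false true = refl
    quarters false false = refl

  orbits-α-cut : OrbitChoice.orbits α-cut-orbits ≡ (insideΓ + outsideΓ) + (insideEdges + outsideEdges)
  orbits-α-cut = trans (sum-cong-≗ (λ x → trans (α-rep-fixed x) (regroup (In x) (Γ x) (x <ᵇ α x))))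
    (∑-distrib-+₄ (λ x → ⟦ In x ∧ Γ x ⟧) (λ x → ⟦ not (In x) ∧ Γ x ⟧)
                  (λ x → ⟦ (In x ∧ not (Γ x)) ∧ x <ᵇ α x ⟧) (λ x → ⟦ (not (In x) ∧ not (Γ x)) ∧ x <ᵇ α x ⟧))
    where
    regroup : ∀ i c l → ⟦ c ⟧ + ⟦ not c ∧ l ⟧ ≡ (⟦ i ∧ c ⟧ + ⟦ not i ∧ c ⟧) + (⟦ (i ∧ not c) ∧ l ⟧ + ⟦ (not i ∧ not c) ∧ l ⟧)
    regroup true true l = refl
    regroup true false true = refl
    regroup true false false = refl
    regroup false true l = refl
    regroup false false true = refl
    regroup false false false = refl

  orbits-φ-cut : OrbitChoice.orbits φ-cut-orbits ≡ (outsideΓ + (outsideEdges + outsideEdges)) + insideFaces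
  orbits-φ-cut = begin
    ∑[ x < nD ] ⟦ does (φ-rep x ≟ x) ⟧
      ≡⟨ trans (sum-cong-≗ φ-rep-fixed) (∑-distrib-+ {nD} _ _) ⟩
    ∑[ x < nD ] ⟦ not (In x) ⟧ + insideFaces
      ≡⟨ cong (_+ insideFaces) (∑-split nD (not ∘ In) Γ (λ _ → 1)) ⟩
    (outsideΓ + count (λ x → not (In x) ∧ not (Γ x))) + insideFaces
      ≡⟨ cong (λ c → (outsideΓ + c) + insideFaces) count-outside-off-γ ⟩
    (outsideΓ + (outsideEdges + outsideEdges)) + insideFaces ∎
    where open ≡-Reasoning

  orbits-σ-cut : OrbitChoice.orbits σ-cut-orbits ≡ ((outsideΓ + outsideEdges) + 1) + insideVertices
  orbits-σ-cut = begin
    ∑[ x < nD ] ⟦ does (σ-rep x ≟ x) ⟧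
      ≡⟨ trans (sum-cong-≗ σ-rep-fixed) (trans (∑-distrib-+ {nD} _ _) (cong (_+ insideVertices)
           (trans (∑-distrib-+ {nD} _ _) (cong (_+ ∑[ x < nD ] ⟦ does (γin zero ≟ x) ⟧) (∑-distrib-+ {nD} _ _))))) ⟩
    ((outsideΓ + outsideEdges) + ∑[ x < nD ] ⟦ does (γin zero ≟ x) ⟧) + insideVertices
      ≡⟨ cong (λ c → ((outsideΓ + outsideEdges) + c) + insideVertices) (∑-select′ nD (γin zero) (λ _ → 1)) ⟩
    ((outsideΓ + outsideEdges) + 1) + insideVertices ∎
    where open ≡-Reasoning

  -- Euler's relation for the inside of γ modulo 2, from sign φ-cut = sign σ-cut · sign α-cut
  parity-insideFaces : parity insideFaces ≡ parity (1 + insideVertices + insideEdges)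
  parity-insideFaces = parity-+-cancelˡ insideΓ insideFaces (1 + insideVertices + insideEdges) (begin
    parity (insideΓ + insideFaces)
      ≡⟨ parity-+-double (insideΓ + insideFaces) (outsideΓ + insideEdges + (outsideEdges + outsideEdges)) ⟨
    parity ((insideΓ + insideFaces) + ((outsideΓ + insideEdges + (outsideEdges + outsideEdges))
                                     + (outsideΓ + insideEdges + (outsideEdges + outsideEdges))))
      ≡⟨ cong parity (rearrangeφ insideΓ outsideΓ insideEdges outsideEdges insideFaces) ⟩
    parity (((insideΓ + outsideΓ) + ((insideEdges + insideEdges) + (outsideEdges + outsideEdges)))
             + ((outsideΓ + (outsideEdges + outsideEdges)) + insideFaces))
      ≡⟨ cong (λ n → parity (n + ((outsideΓ + (outsideEdges + outsideEdges)) + insideFaces))) darts ⟨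
    parity (N + ((outsideΓ + (outsideEdges + outsideEdges)) + insideFaces))
      ≡⟨ cong (λ o → parity (N + o)) orbits-φ-cut ⟨
    parity (N + OrbitChoice.orbits φ-cut-orbits)
      ≡⟨ parity-orbits-∘ nD σ-cut α-cut α-cut φ-cut σ-cut-injective α-cut-involutive α-cut-involutive
           φ-cut≗σ-cut∘α-cut σ-cut-orbits α-cut-orbits φ-cut-orbits ⟩
    parity ((N + OrbitChoice.orbits σ-cut-orbits) + (N + OrbitChoice.orbits α-cut-orbits))
      ≡⟨ cong parity (cong₂ (λ o o′ → (N + o) + (N + o′)) orbits-σ-cut orbits-α-cut) ⟩
    parity ((N + (((outsideΓ + outsideEdges) + 1) + insideVertices)) + (N + ((insideΓ + outsideΓ) + (insideEdges + outsideEdges))))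
      ≡⟨ cong parity (rearrangeσα N insideΓ outsideΓ insideEdges outsideEdges insideVertices) ⟩
    parity ((insideΓ + (1 + insideVertices + insideEdges)) + ((N + outsideΓ + outsideEdges) + (N + outsideΓ + outsideEdges)))
      ≡⟨ parity-+-double (insideΓ + (1 + insideVertices + insideEdges)) (N + outsideΓ + outsideEdges) ⟩
    parity (insideΓ + (1 + insideVertices + insideEdges)) ∎)
    where
    open ≡-Reasoning
    N : ℕ
    N = nD
    rearrangeφ : ∀ iΓ oΓ iE oE iF →
      (iΓ + iF) + ((oΓ + iE + (oE + oE)) + (oΓ + iE + (oE + oE))) ≡
      ((iΓ + oΓ) + ((iE + iE) + (oE + oE))) + ((oΓ + (oE + oE)) + iF)
    rearrangeφ = solve-∀
    rearrangeσα : ∀ n iΓ oΓ iE oE iV →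
      (n + (((oΓ + oE) + 1) + iV)) + (n + ((iΓ + oΓ) + (iE + oE))) ≡
      (iΓ + (1 + iV + iE)) + ((n + oΓ + oE) + (n + oΓ + oE))
    rearrangeσα = solve-∀

  black : Fin nD → Bool
  black x = colour (tail x)

  black-α : ∀ x → black (α x) ≡ not (black x)
  black-α x = ¬-not (bipartite x ∘ sym)

  black-φ : ∀ x → black (φ x) ≡ not (black x)
  black-φ x = trans (cong colour (tail-σ (α x))) (black-α x)

  blackCorners : Fin nF → ℕ
  blackCorners f = ∑[ x < nD ] (if does (face x ≟ f) then ⟦ black x ⟧ else 0)

  -- φ preserves faces and swaps colours, so half the darts of each face start at a black vertex
  faceSize≡blackCorners+blackCorners : ∀ f → faceSize M f ≡ blackCorners f + blackCorners f
  faceSize≡blackCorners+blackCorners f = begin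
    faceSize M f
      ≡⟨ countFin≡∑ nD (λ x → does (face x ≟ f)) ⟩
    ∑[ x < nD ] ⟦ does (face x ≟ f) ⟧
      ≡⟨ ∑-split nD (λ x → does (face x ≟ f)) black (λ _ → 1) ⟩
    ∑[ x < nD ] ⟦ does (face x ≟ f) ∧ black x ⟧ + ∑[ x < nD ] ⟦ does (face x ≟ f) ∧ not (black x) ⟧
      ≡⟨ cong₂ _+_ (sum-cong-≗ (λ x → if-∧ (does (face x ≟ f)))) (sym (∑-reindex nD φ φ⁻¹ φ⁻¹-φ φ-φ⁻¹ white)) ⟩
    blackCorners f + ∑[ x < nD ] white (φ x)
      ≡⟨ cong (blackCorners f +_) (sum-cong-≗ white-φ) ⟩
    blackCorners f + blackCorners f ∎
    where
    open ≡-Reasoning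
    white : Fin nD → ℕ
    white y = ⟦ does (face y ≟ f) ∧ not (black y) ⟧
    white-φ : ∀ x → white (φ x) ≡ (if does (face x ≟ f) then ⟦ black x ⟧ else 0)
    white-φ x = trans (cong₂ (λ g b → ⟦ does (g ≟ f) ∧ not b ⟧) (face-φ x) (black-φ x))
      (trans (cong (λ b → ⟦ does (face x ≟ f) ∧ b ⟧) (not-involutive (black x))) (if-∧ (does (face x ≟ f))))

  half-faceSize : ∀ f → faceSize M f / 2 ≡ blackCorners f
  half-faceSize f = trans (cong (_/ 2) (faceSize≡blackCorners+blackCorners f)) (half-double (blackCorners f))

  insideFaces≡ : ∑[ f < nF ] ⟦ inside f ⟧ ≡ insideFaces
  insideFaces≡ = trans (sum-cong-≗ per-face) (∑-fibres nD nF face (λ x → ⟦ In x ∧ does (faceRep (face x) ≟ x) ⟧))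
    where
    per-face : ∀ f → ⟦ inside f ⟧ ≡ ∑[ x < nD ] (if does (face x ≟ f) then ⟦ In x ∧ does (faceRep (face x) ≟ x) ⟧ else 0)
    per-face f = sym (trans (sum-cong-≗ (λ x → sym (if-∧ (does (face x ≟ f))))) (bool-cases (inside f)
      (λ in-f → trans (∑-unique nD _ (λ _ → 1) (faceRep f)
          (∧-intro (dec-true (face (faceRep f) ≟ f) (face-faceRep f))
            (∧-intro (trans (cong inside (face-faceRep f)) in-f) (dec-true (faceRep (face (faceRep f)) ≟ faceRep f) (cong faceRep (face-faceRep f)))))
          (λ x hit → let face-x , rest = ∧-true hit in
            trans (sym (does-true (faceRep (face x) ≟ x) (proj₂ (∧-true rest)))) (cong faceRep (does-true (face x ≟ f) face-x))))
        (cong ⟦_⟧ (sym in-f)))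
      (λ out-f → trans (∑-none nD _ (λ _ → 1) (λ x → bool-cases (does (face x ≟ f) ∧ (In x ∧ does (faceRep (face x) ≟ x)))
          (λ hit → let face-x , rest = ∧-true hit in
            contradiction (trans (sym (proj₁ (∧-true rest))) (trans (cong inside (does-true (face x ≟ f) face-x)) out-f)) λ ())
          (λ miss → miss)))
        (cong ⟦_⟧ (sym out-f)))))

  ∑-inside-γ : ∀ (g : Fin nD → ℕ) → ∑[ x < nD ] (if In x ∧ Γ x then g x else 0) ≡ ∑[ i < suc m ] g (γin i)
  ∑-inside-γ g = begin
    ∑[ x < nD ] (if In x ∧ Γ x then g x else 0)
      ≡⟨ sum-cong-≗ per-dart ⟩
    ∑[ x < nD ] ∑[ i < suc m ] (if does (γin i ≟ x) then g x else 0)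
      ≡⟨ ∑-comm {nD} {suc m} (λ x i → if does (γin i ≟ x) then g x else 0) ⟩
    ∑[ i < suc m ] ∑[ x < nD ] (if does (γin i ≟ x) then g x else 0)
      ≡⟨ sum-cong-≗ (λ i → ∑-select′ nD (γin i) g) ⟩
    ∑[ i < suc m ] g (γin i) ∎
    where
    open ≡-Reasoning
    per-dart : ∀ x → (if In x ∧ Γ x then g x else 0) ≡ ∑[ i < suc m ] (if does (γin i ≟ x) then g x else 0)
    per-dart x = bool-cases (In x ∧ Γ x)
      (λ hit → let In-x , on = ∧-true hit ; i , γin-i≡x = γin-surjective x on In-x in
        trans (cong (if_then g x else 0) hit) (sym (∑-unique (suc m) (λ j → does (γin j ≟ x)) (λ _ → g x) i
          (dec-true (γin i ≟ x) γin-i≡x) (λ j hit′ → γin-injective (trans (does-true (γin j ≟ x) hit′) (sym γin-i≡x))))))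
      (λ miss → trans (cong (if_then g x else 0) miss) (sym (∑-none (suc m) (λ j → does (γin j ≟ x)) (λ _ → g x)
          (λ j → bool-cases (does (γin j ≟ x))
            (λ hit → contradiction (trans (sym (subst (λ z → (In z ∧ Γ z) ≡ true) (does-true (γin j ≟ x) hit)
                                                   (∧-intro (In-γin j) (Γ-γin j)))) miss) λ ())
            (λ other → other)))))

  blackOnγ : ℕ
  blackOnγ = ∑[ i < suc m ] ⟦ black (γ i) ⟧

  -- colours alternate along γ
  whiteOnγ≡blackOnγ : ∑[ i < suc m ] ⟦ not (black (γ i)) ⟧ ≡ blackOnγ
  whiteOnγ≡blackOnγ = trans (sum-cong-≗ (λ i → cong ⟦_⟧ (sym (trans (cong colour (sym (consecutive i))) (black-α (γ i))))))
    (∑-reindex (suc m) cyc cyc⁻¹ cyc⁻¹-cyc cyc-cyc⁻¹ (λ i → ⟦ black (γ i) ⟧))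

  half-length : suc m / 2 ≡ blackOnγ
  half-length = trans (cong (_/ 2) (sym length≡)) (half-double blackOnγ)
    where
    length≡ : blackOnγ + blackOnγ ≡ suc m
    length≡ = begin
      blackOnγ + blackOnγ                                               ≡⟨ cong (blackOnγ +_) whiteOnγ≡blackOnγ ⟨
      blackOnγ + ∑[ i < suc m ] ⟦ not (black (γ i)) ⟧                  ≡⟨ ∑-distrib-+ {suc m} (λ i → ⟦ black (γ i) ⟧) (λ i → ⟦ not (black (γ i)) ⟧) ⟨
      ∑[ i < suc m ] (⟦ black (γ i) ⟧ + ⟦ not (black (γ i)) ⟧)          ≡⟨ sum-cong-≗ (λ i → one (black (γ i))) ⟩
      ∑[ i < suc m ] 1                                                  ≡⟨ ∑-one (suc m) ⟩
      suc m                                                             ∎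
      where
      open ≡-Reasoning
      one : ∀ b → ⟦ b ⟧ + ⟦ not b ⟧ ≡ 1
      one true = refl
      one false = refl

  blackOnγin : ∑[ i < suc m ] ⟦ black (γin i) ⟧ ≡ blackOnγ
  blackOnγin = bool-cases insideOnRight
    (λ o → sum-cong-≗ (λ i → cong (⟦_⟧ ∘ black) (γin-right o i)))
    (λ o → trans (sum-cong-≗ (λ i → trans (cong (⟦_⟧ ∘ black) (γin-left o i)) (cong ⟦_⟧ (black-α (γ i))))) whiteOnγ≡blackOnγ)

  black-inside-off-γ : ∑[ x < nD ] (if In x ∧ not (Γ x) then ⟦ black x ⟧ else 0) ≡ insideEdges
  black-inside-off-γ = trans (sym (half-double Y)) (trans (cong (λ z → (Y + z) / 2) (sym white≡black))
    (trans (cong (_/ 2) (trans (sym (∑-distrib-+ {nD} _ _)) (trans (sum-cong-≗ (λ x → split (T x) (black x))) count-inside-off-γ)))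
           (half-double insideEdges)))
    where
    T : Fin nD → Bool
    T x = In x ∧ not (Γ x)
    Y : ℕ
    Y = ∑[ x < nD ] (if T x then ⟦ black x ⟧ else 0)
    white≡black : ∑[ x < nD ] (if T x then ⟦ not (black x) ⟧ else 0) ≡ Y
    white≡black = trans (sum-cong-≗ (λ x → sym (cong₂ (λ t b → if t then ⟦ b ⟧ else 0) (count-In∧¬Γ-α x) (black-α x))))
      (∑-reindex nD α α α-invol α-invol (λ x → if T x then ⟦ black x ⟧ else 0))
    split : ∀ t b → (if t then ⟦ b ⟧ else 0) + (if t then ⟦ not b ⟧ else 0) ≡ ⟦ t ⟧
    split true true = refl
    split true false = refl
    split false b = refl

  black-inside : ∑[ x < nD ] (if In x then ⟦ black x ⟧ else 0) ≡ suc m / 2 + insideEdges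
  black-inside = begin
    ∑[ x < nD ] (if In x then ⟦ black x ⟧ else 0)
      ≡⟨ ∑-split nD In Γ (⟦_⟧ ∘ black) ⟩
    ∑[ x < nD ] (if In x ∧ Γ x then ⟦ black x ⟧ else 0) + ∑[ x < nD ] (if In x ∧ not (Γ x) then ⟦ black x ⟧ else 0)
      ≡⟨ cong₂ _+_ (trans (∑-inside-γ (⟦_⟧ ∘ black)) (trans blackOnγin (sym half-length))) black-inside-off-γ ⟩
    suc m / 2 + insideEdges ∎
    where open ≡-Reasoning

  enclosedᵛ : Fin nV → Bool
  enclosedᵛ = enclosed M γ inside

  In-vertexRep-enclosed : ∀ {v} → enclosedᵛ v ≡ true → Γᵛ v ≡ false × In (vertexRep v) ≡ true
  In-vertexRep-enclosed {v} enc with ∧-true enc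
  ... | off , some with anyFin-witness nD _ some
  ...   | x , hit with ∧-true hit
  ...     | tail-x , In-x = not-true off ,
    trans (In-at-vertex-off-γ x (vertexRep v) (trans (cong Γᵛ tail-x′) (not-true off)) (trans tail-x′ (sym (tail-vertexRep v)))) In-x
    where
    tail-x′ : tail x ≡ v
    tail-x′ = does-true (tail x ≟ v) tail-x

  insideVertices≡enclosed : insideVertices ≡ ∑[ v < nV ] ⟦ enclosedᵛ v ⟧
  insideVertices≡enclosed = sym (trans (sum-cong-≗ per-vertex) (∑-fibres nD nV tail (⟦_⟧ ∘ Q)))
    where
    Q : Fin nD → Bool
    Q x = In x ∧ (not (Γᵛ (tail x)) ∧ does (vertexRep (tail x) ≟ x))
    per-vertex : ∀ v → ⟦ enclosedᵛ v ⟧ ≡ ∑[ x < nD ] (if does (tail x ≟ v) then ⟦ Q x ⟧ else 0)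
    per-vertex v = sym (trans (sum-cong-≗ (λ x → sym (if-∧ (does (tail x ≟ v))))) (bool-cases (enclosedᵛ v)
      (λ enc → let off , In-rep = In-vertexRep-enclosed enc in
        trans (∑-unique nD (λ x → does (tail x ≟ v) ∧ Q x) (λ _ → 1) (vertexRep v)
          (∧-intro (dec-true (tail (vertexRep v) ≟ v) (tail-vertexRep v))
            (∧-intro In-rep (∧-intro (cong not (trans (cong Γᵛ (tail-vertexRep v)) off))
              (dec-true (vertexRep (tail (vertexRep v)) ≟ vertexRep v) (cong vertexRep (tail-vertexRep v))))))
          unique)
        (cong ⟦_⟧ (sym enc)))
      (λ not-enc → trans (∑-none nD (λ x → does (tail x ≟ v) ∧ Q x) (λ _ → 1) (λ x → bool-cases (does (tail x ≟ v) ∧ Q x)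
          (λ hit → contradiction (trans (sym (enclosed-at x hit)) not-enc) λ ())
          (λ miss → miss)))
        (cong ⟦_⟧ (sym not-enc)))))
      where
      unique : ∀ x → (does (tail x ≟ v) ∧ Q x) ≡ true → x ≡ vertexRep v
      unique x hit with ∧-true hit
      ... | tail-x , Qx with ∧-true {In x} Qx
      ...   | _ , rest with ∧-true {not (Γᵛ (tail x))} rest
      ...     | _ , is-rep = trans (sym (does-true (vertexRep (tail x) ≟ x) is-rep)) (cong vertexRep (does-true (tail x ≟ v) tail-x))
      enclosed-at : ∀ x → (does (tail x ≟ v) ∧ Q x) ≡ true → enclosedᵛ v ≡ true
      enclosed-at x hit with ∧-true hit
      ... | tail-x , Qx with ∧-true Qx
      ...   | In-x , rest = ∧-intro (trans (cong (not ∘ Γᵛ) (sym (does-true (tail x ≟ v) tail-x))) (proj₁ (∧-true rest)))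
                                    (anyFin-intro nD _ x (∧-intro tail-x In-x))

  enclosed-at : ∀ d → Γᵛ (tail d) ≡ false → enclosedᵛ (tail d) ≡ In d
  enclosed-at d off rewrite off = bool-cases (In d)
    (λ In-d → trans (anyFin-intro nD _ d (∧-intro (dec-true (tail d ≟ tail d) refl) In-d)) (sym In-d))
    (λ out-d → bool-cases (anyFin nD (λ x → does (tail x ≟ tail d) ∧ In x))
      (λ some → let x , hit = anyFin-witness nD _ some ; tail-x , In-x = ∧-true hit in
        contradiction (trans (sym In-x) (trans (In-at-vertex-off-γ d x off (sym (does-true (tail x ≟ tail d) tail-x))) out-d)) λ ())
      (λ none → trans none (sym out-d)))

  module Kasteleyn (n : Fin nV → ℕ) (cil : Fin nV → Fin nD)
    (cilium-at : ∀ v → isEven (n v) ≡ true → tail (cil v) ≡ v)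
    (ε : Fin nD → Sign) (ε-α : ∀ x → ε (α x) ≡ ε x) (kasteleyn : IsKasteleyn M n cil ε) where

    e : Fin nD → ℕ
    e x = signExponent (ε x)

    even : Fin nV → Bool
    even v = isEven (n v)

    ciliumFace : Fin nV → Fin nF
    ciliumFace v = face (σ (cil v))

    faceExponent : Fin nF → ℕ
    faceExponent f = ∑[ x < nD ] (if does (face x ≟ f) then e x else 0)

    ciliaAt : Fin nF → ℕ
    ciliaAt f = ∑[ v < nV ] (if does (ciliumFace v ≟ f) then ⟦ even v ⟧ else 0)

    parity-faceExponent : ∀ f → inside f ≡ true → parity (faceExponent f) ≡ parity (blackCorners f + 1 + ciliaAt f)
    parity-faceExponent f in-f = begin
      parity (faceExponent f)
        ≡⟨ signPow-injective (faceExponent f) (faceSize M f / 2 + 1 + ciliaIn M n cil f) (trans (sym faceProd≡) (kasteleyn f f≢outer)) ⟩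
      parity (faceSize M f / 2 + 1 + ciliaIn M n cil f)
        ≡⟨ cong parity (cong₂ (λ a c → a + 1 + c) (half-faceSize f) ciliaIn≡ciliaAt) ⟩
      parity (blackCorners f + 1 + ciliaAt f) ∎
      where
      open ≡-Reasoning
      f≢outer : f ≢ outer
      f≢outer refl = contradiction (trans (sym in-f) outer-outside) λ ()
      faceProd≡ : faceProd M ε f ≡ signPow (faceExponent f)
      faceProd≡ = trans (prodFin≡signPow nD _) (cong signPow (sum-cong-≗ (λ x → if-float signExponent (does (face x ≟ f)))))
      ciliaIn≡ciliaAt : ciliaIn M n cil f ≡ ciliaAt f
      ciliaIn≡ciliaAt = trans (countFin≡∑ nV _) (sum-cong-≗ (λ v → ⟦∧⟧≡if (even v) (does (ciliumFace v ≟ f))))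

    insideExponent : ℕ
    insideExponent = ∑[ x < nD ] (if In x then e x else 0)

    -- the edges inside γ carry the same sign on both sides and so count twice
    parity-γ-exponent : parity (∑[ i < suc m ] e (γ i)) ≡ parity insideExponent
    parity-γ-exponent = begin
      parity (∑[ i < suc m ] e (γ i))
        ≡⟨ parity-+-double (∑[ i < suc m ] e (γ i)) interiorEdges ⟨
      parity (∑[ i < suc m ] e (γ i) + (interiorEdges + interiorEdges))
        ≡⟨ cong parity (cong₂ _+_ (trans (sum-cong-≗ e-γin) (sym (∑-inside-γ e)))
             (sym (∑-involution nD α α-invol α-nofix (λ x → if In x ∧ not (Γ x) then e x else 0) off-γ-α))) ⟩
      parity (∑[ x < nD ] (if In x ∧ Γ x then e x else 0) + ∑[ x < nD ] (if In x ∧ not (Γ x) then e x else 0))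
        ≡⟨ cong parity (∑-split nD In Γ e) ⟨
      parity insideExponent ∎
      where
      open ≡-Reasoning
      interiorEdges : ℕ
      interiorEdges = ∑[ x < nD ] (if x <ᵇ α x then (if In x ∧ not (Γ x) then e x else 0) else 0)
      e-γin : ∀ i → e (γ i) ≡ e (γin i)
      e-γin i = bool-cases insideOnRight (λ o → cong e (sym (γin-right o i)))
        (λ o → trans (cong signExponent (sym (ε-α (γ i)))) (cong e (sym (γin-left o i))))
      off-γ-α : ∀ x → (if In (α x) ∧ not (Γ (α x)) then e (α x) else 0) ≡ (if In x ∧ not (Γ x) then e x else 0)
      off-γ-α x = cong₂ (if_then_else 0) (count-In∧¬Γ-α x) (cong signExponent (ε-α x))

    parity-if : ∀ b u v → (b ≡ true → parity u ≡ parity v) → parity (if b then u else 0) ≡ parity (if b then v else 0)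
    parity-if true u v eq = eq refl
    parity-if false u v eq = refl

    parity-insideExponent : parity insideExponent ≡
      parity (∑[ f < nF ] (if inside f then blackCorners f + 1 + ciliaAt f else 0))
    parity-insideExponent = trans (cong parity (sym (∑-fibres-restricted nD nF face inside e)))
      (parity-∑-cong nF _ _ (λ f → parity-if (inside f) _ _ (parity-faceExponent f)))

    enclosedEven enclosedOdd : ℕ
    enclosedEven = ∑[ v < nV ] ⟦ enclosedᵛ v ∧ even v ⟧
    enclosedOdd = ∑[ v < nV ] ⟦ enclosedᵛ v ∧ not (even v) ⟧

    cilia-on-γ : ∑[ v < nV ] ⟦ (even v ∧ inside (ciliumFace v)) ∧ Γᵛ v ⟧ ≡ ciliaInside M γ inside n cil
    cilia-on-γ = begin
      ∑[ v < nV ] ⟦ R v ∧ Γᵛ v ⟧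
        ≡⟨ sum-cong-≗ per-vertex ⟩
      ∑[ v < nV ] ∑[ i < suc m ] (if does (tail (γ i) ≟ v) then ⟦ R v ⟧ else 0)
        ≡⟨ ∑-comm {nV} {suc m} (λ v i → if does (tail (γ i) ≟ v) then ⟦ R v ⟧ else 0) ⟩
      ∑[ i < suc m ] ∑[ v < nV ] (if does (tail (γ i) ≟ v) then ⟦ R v ⟧ else 0)
        ≡⟨ sum-cong-≗ (λ i → ∑-select′ nV (tail (γ i)) (⟦_⟧ ∘ R)) ⟩
      ∑[ i < suc m ] ⟦ R (tail (γ i)) ⟧
        ≡⟨ countFin≡∑ (suc m) (R ∘ tail ∘ γ) ⟨
      ciliaInside M γ inside n cil ∎
      where
      open ≡-Reasoning
      R : Fin nV → Bool
      R v = even v ∧ inside (ciliumFace v)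
      per-vertex : ∀ v → ⟦ R v ∧ Γᵛ v ⟧ ≡ ∑[ i < suc m ] (if does (tail (γ i) ≟ v) then ⟦ R v ⟧ else 0)
      per-vertex v = bool-cases (Γᵛ v)
        (λ on → let i , tail-γi = Γᵛ-cases v on in
          trans (cong (λ b → ⟦ R v ∧ b ⟧) on) (trans (cong ⟦_⟧ (∧-identityʳ (R v)))
            (sym (∑-unique (suc m) (λ j → does (tail (γ j) ≟ v)) (λ _ → ⟦ R v ⟧) i (dec-true (tail (γ i) ≟ v) tail-γi)
              (λ j hit → distinct-vertices j i (trans (does-true (tail (γ j) ≟ v) hit) (sym tail-γi)))))))
        (λ off → trans (cong (λ b → ⟦ R v ∧ b ⟧) off) (trans (cong ⟦_⟧ (∧-zeroʳ (R v)))
            (sym (∑-none (suc m) (λ j → does (tail (γ j) ≟ v)) (λ _ → ⟦ R v ⟧) (λ j → bool-cases (does (tail (γ j) ≟ v))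
              (λ hit → contradiction (trans (sym (Γᵛ-γ j)) (trans (cong Γᵛ (does-true (tail (γ j) ≟ v) hit)) off)) λ ())
              (λ miss → miss))))))

    cilia-off-γ : ∀ v → ((even v ∧ inside (ciliumFace v)) ∧ not (Γᵛ v)) ≡ (enclosedᵛ v ∧ even v)
    cilia-off-γ v = bool-cases (Γᵛ v)
      (λ on → trans (cong (λ b → (even v ∧ inside (ciliumFace v)) ∧ not b) on)
        (trans (∧-zeroʳ (even v ∧ inside (ciliumFace v))) (sym (cong (λ b → (not b ∧ enclosedAny) ∧ even v) on))))
      (λ off → bool-cases (even v)
        (λ ev → begin
          ((even v ∧ inside (ciliumFace v)) ∧ not (Γᵛ v)) ≡⟨ cong₂ (λ a b → (a ∧ inside (ciliumFace v)) ∧ not b) ev off ⟩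
          inside (ciliumFace v) ∧ true                    ≡⟨ ∧-identityʳ (inside (ciliumFace v)) ⟩
          In (σ (cil v))                                  ≡⟨ enclosed-at (σ (cil v)) (trans (cong Γᵛ (tail-cilium ev)) off) ⟨
          enclosedᵛ (tail (σ (cil v)))                    ≡⟨ cong enclosedᵛ (tail-cilium ev) ⟩
          enclosedᵛ v                                     ≡⟨ ∧-identityʳ (enclosedᵛ v) ⟨
          enclosedᵛ v ∧ true                              ≡⟨ cong (enclosedᵛ v ∧_) ev ⟨
          enclosedᵛ v ∧ even v                            ∎)
        (λ od → trans (cong (λ a → (a ∧ inside (ciliumFace v)) ∧ not (Γᵛ v)) od)
          (sym (trans (cong (enclosedᵛ v ∧_) od) (∧-zeroʳ (enclosedᵛ v))))))
      where
      enclosedAny : Bool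
      enclosedAny = anyFin nD (λ x → does (tail x ≟ v) ∧ inside (face x))
      open ≡-Reasoning
      tail-cilium : even v ≡ true → tail (σ (cil v)) ≡ v
      tail-cilium ev = trans (tail-σ (cil v)) (cilium-at v ev)

    cilia-inside : ∑[ v < nV ] (if inside (ciliumFace v) then ⟦ even v ⟧ else 0) ≡ ciliaInside M γ inside n cil + enclosedEven
    cilia-inside = begin
      ∑[ v < nV ] (if inside (ciliumFace v) then ⟦ even v ⟧ else 0)
        ≡⟨ sum-cong-≗ (λ v → sym (⟦∧⟧≡if (even v) (inside (ciliumFace v)))) ⟩
      ∑[ v < nV ] ⟦ even v ∧ inside (ciliumFace v) ⟧
        ≡⟨ ∑-split nV (λ v → even v ∧ inside (ciliumFace v)) Γᵛ (λ _ → 1) ⟩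
      ∑[ v < nV ] ⟦ (even v ∧ inside (ciliumFace v)) ∧ Γᵛ v ⟧ + ∑[ v < nV ] ⟦ (even v ∧ inside (ciliumFace v)) ∧ not (Γᵛ v) ⟧
        ≡⟨ cong₂ _+_ cilia-on-γ (sum-cong-≗ (cong ⟦_⟧ ∘ cilia-off-γ)) ⟩
      ciliaInside M γ inside n cil + enclosedEven ∎
      where open ≡-Reasoning

    faces-sum : ∑[ f < nF ] (if inside f then blackCorners f + 1 + ciliaAt f else 0) ≡
      (suc m / 2 + insideEdges) + insideFaces + (ciliaInside M γ inside n cil + enclosedEven)
    faces-sum = begin
      ∑[ f < nF ] (if inside f then blackCorners f + 1 + ciliaAt f else 0)
        ≡⟨ trans (sum-cong-≗ (λ f → split (inside f) (blackCorners f) (ciliaAt f)))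
                 (trans (∑-distrib-+ {nF} _ _) (cong (_+ ∑[ f < nF ] (if inside f then ciliaAt f else 0)) (∑-distrib-+ {nF} _ _))) ⟩
      ∑[ f < nF ] (if inside f then blackCorners f else 0) + ∑[ f < nF ] ⟦ inside f ⟧ + ∑[ f < nF ] (if inside f then ciliaAt f else 0)
        ≡⟨ cong₂ (λ a c → a + ∑[ f < nF ] ⟦ inside f ⟧ + c) (∑-fibres-restricted nD nF face inside (⟦_⟧ ∘ black))
                                                         (∑-fibres-restricted nV nF ciliumFace inside (⟦_⟧ ∘ even)) ⟩
      ∑[ x < nD ] (if In x then ⟦ black x ⟧ else 0) + ∑[ f < nF ] ⟦ inside f ⟧ + ∑[ v < nV ] (if inside (ciliumFace v) then ⟦ even v ⟧ else 0)
        ≡⟨ cong₂ (λ a b → a + b + ∑[ v < nV ] (if inside (ciliumFace v) then ⟦ even v ⟧ else 0)) black-inside insideFaces≡ ⟩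
      (suc m / 2 + insideEdges) + insideFaces + ∑[ v < nV ] (if inside (ciliumFace v) then ⟦ even v ⟧ else 0)
        ≡⟨ cong ((suc m / 2 + insideEdges) + insideFaces +_) cilia-inside ⟩
      (suc m / 2 + insideEdges) + insideFaces + (ciliaInside M γ inside n cil + enclosedEven) ∎
      where
      open ≡-Reasoning
      split : ∀ b a c → (if b then a + 1 + c else 0) ≡ (if b then a else 0) + ⟦ b ⟧ + (if b then c else 0)
      split true a c = refl
      split false a c = refl

    enclosed-split : insideVertices ≡ enclosedEven + enclosedOdd
    enclosed-split = trans insideVertices≡enclosed (∑-split nV enclosedᵛ even (λ _ → 1))

    parity-nInt : parity (nInt M γ inside n) ≡ parity enclosedOdd
    parity-nInt = trans (cong parity (sumFin≡∑ nV _)) (parity-∑-cong nV _ _ (λ v → odd-part (enclosedᵛ v) v))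
      where
      odd-part : ∀ b v → parity (if b then n v else 0) ≡ parity ⟦ b ∧ not (even v) ⟧
      odd-part true v = sym (parity-⟦not-isEven⟧ (n v))
      odd-part false v = refl

-- Only the parity of each n v matters.
lemma1 : (M : PlaneBipartiteMap) →
    (n : Fin (PlaneBipartiteMap.nV M) → ℕ) →
    (∀ v → 0 < n v) →
    (cil : Fin (PlaneBipartiteMap.nV M) → Fin (PlaneBipartiteMap.nD M)) →
    (∀ v → isEven (n v) ≡ true → PlaneBipartiteMap.tail M (cil v) ≡ v) →
    (ε : Fin (PlaneBipartiteMap.nD M) → Sign) →
    (∀ x → ε (PlaneBipartiteMap.α M x) ≡ ε x) →
    IsKasteleyn M n cil ε →
    (m : ℕ) → (γ : Fin (suc m) → Fin (PlaneBipartiteMap.nD M)) →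
    IsSimpleCycle M m γ →
    (inside : Fin (PlaneBipartiteMap.nF M) → Bool) →
    IsInterior M γ inside →
    prodFin (suc m) (λ i → ε (γ i))
      ≡ signPow (suc m / 2 + 1 + ciliaInside M γ inside n cil + nInt M γ inside n)
lemma1 M n _ cil cilium-at ε ε-α kasteleyn m γ simple inside interior =
  trans (prodFin≡signPow (suc m) (λ i → ε (γ i))) (signPow-cong (∑[ i < suc m ] e (γ i)) (L + 1 + k + nInt M γ inside n) (begin
    parity (∑[ i < suc m ] e (γ i))
      ≡⟨ parity-γ-exponent ⟩
    parity insideExponent
      ≡⟨ parity-insideExponent ⟩
    parity (∑[ f < nF ] (if inside f then blackCorners f + 1 + ciliaAt f else 0))
      ≡⟨ cong parity faces-sum ⟩
    parity ((L + insideEdges) + insideFaces + (k + enclosedEven))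
      ≡⟨ parity-+-cong ((L + insideEdges) + insideFaces) (k + enclosedEven) ((L + insideEdges) + euler) (k + enclosedEven)
           (parity-+-cong (L + insideEdges) insideFaces (L + insideEdges) euler refl
             (trans parity-insideFaces (cong (λ v → parity (1 + v + insideEdges)) enclosed-split))) refl ⟩
    parity ((L + insideEdges) + (1 + (enclosedEven + enclosedOdd) + insideEdges) + (k + enclosedEven))
      ≡⟨ cong parity (rearrange L insideEdges enclosedEven enclosedOdd k) ⟩
    parity ((L + 1 + k + enclosedOdd) + ((insideEdges + enclosedEven) + (insideEdges + enclosedEven)))
      ≡⟨ parity-+-double (L + 1 + k + enclosedOdd) (insideEdges + enclosedEven) ⟩
    parity (L + 1 + k + enclosedOdd)
      ≡⟨ parity-+-cong (L + 1 + k) enclosedOdd (L + 1 + k) (nInt M γ inside n) refl (sym parity-nInt) ⟩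
    parity (L + 1 + k + nInt M γ inside n) ∎))
  where
  open ≡-Reasoning
  open PlaneBipartiteMap M using (nF)
  open InsideOfCycle M m γ simple inside interior
  open Kasteleyn n cil cilium-at ε ε-α kasteleyn
  L euler k : ℕ
  L = suc m / 2
  euler = 1 + (enclosedEven + enclosedOdd) + insideEdges
  k = ciliaInside M γ inside n cil
  rearrange : ∀ l iE eE eO c → (l + iE) + (1 + (eE + eO) + iE) + (c + eE) ≡ (l + 1 + c + eO) + ((iE + eE) + (iE + eE))
  rearrange = solve-∀
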